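{- For every positive integer $n$, \[ q^{\binom{n}{2}}C_n\!\left(\tfrac{1}{q}\right)=\sum_{\substack{\lambda=(\lambda_1,\dots,\lambda_k)\\ \lambda_1+k\leq n}}\ \prod_{i \geq 1} \binom{\lambda_i-\lambda_{i+2}+1}{\lambda_{i+1}-\lambda_{i+2}}\, q^{\binom{\lambda_1}{2}+|\lambda|}, \] where the sum runs over all partitions $\lambda$ (including the empty partition) with $k$ nonzero parts and largest part $\lambda_1$ satisfying $\lambda_1+k\le n$.
   Context: A partition $\lambda=(\lambda_1\ge\lambda_2\ge\cdots)$ is identified with its sequence of parts, with $\lambda_i=0$ for $i>k$, where $k$ is the number of nonzero parts; $|\lambda|=\sum_i\lambda_i$, and $\lambda_1=0$ for the empty partition. A Dyck path of length $n$ is a lattice path from $(0,0)$ to $(n,n)$ consisting of unit north steps $(0,1)$ and east steps $(1,0)$ that never goes strictly below the line $y=x$. Its coarea is the number of unit lattice squares lying entirely in the region between the path and the diagonal $y=x$. The Carlitz $q$-Catalan number is $C_n(q)=\sum_{p}q^{\mathrm{coarea}(p)}$, summed over all Dyck paths $p$ of length $n$. -}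

module Defs where

open import Data.Bool using (Bool; true; false; _∧_; if_then_else_)
open import Data.Nat as ℕ using (ℕ; zero; suc; _+_; _∸_; _≤ᵇ_)
open import Data.Nat.Combinatorics using (_C_)
open import Data.List using (List; []; _∷_; length; map; concatMap; foldr; upTo)
open import Data.Rational as ℚ using (ℚ; 1ℚ; 0ℚ)
import Data.Rational as Q
open import Data.Integer using (+_)

infixr 8 _^ℚ_
_^ℚ_ : ℚ → ℕ → ℚ
x ^ℚ zero  = 1ℚ
x ^ℚ suc e = x Q.* (x ^ℚ e)

sumℚ : List ℚ → ℚ
sumℚ = foldr Q._+_ 0ℚ

prodℕ : List ℕ → ℕ
prodℕ = foldr ℕ._*_ 1

bfilter : {A : Set} → (A → Bool) → List A → List A
bfilter f []      = []
bfilter f (x ∷ xs) = if f x then x ∷ bfilter f xs else bfilter f xs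

-- Lattice paths: N = north step (0,1), E = east step (1,0)

data Step : Set where
  N E : Step

allPaths : ℕ → List (List Step)
allPaths zero    = [] ∷ []
allPaths (suc m) = concatMap (λ p → (N ∷ p) ∷ (E ∷ p) ∷ []) (allPaths m)

-- Dyck check: starting with current height h = #N - #E of the prefix
-- read so far, and remaining numbers of N and E steps to use;
-- the path never goes strictly below y = x iff every prefix has #E ≤ #N.
dyckFrom : ℕ → ℕ → ℕ → List Step → Bool
dyckFrom h zero    zero    []      = true
dyckFrom h (suc a) b       (N ∷ p) = dyckFrom (suc h) a b p
dyckFrom (suc h) a (suc b) (E ∷ p) = dyckFrom h a b p
dyckFrom _ _ _ _ = false

isDyck : ℕ → List Step → Bool
isDyck n p = dyckFrom 0 n n p

dyckPaths : ℕ → List (List Step)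
dyckPaths n = bfilter (isDyck n) (allPaths (n + n))

-- coarea: in row i (between y = i and y = i+1) the north step is at
-- x = e_i (number of east steps before it), and the unit squares lying
-- entirely between the path and the diagonal in that row are those
-- [x,x+1]×[i,i+1] with e_i ≤ x and x+1 ≤ i, i.e. i ∸ e_i of them.
-- coareaFrom i e p : i = current row (north steps so far), e = east steps so far
coareaFrom : ℕ → ℕ → List Step → ℕ
coareaFrom i e []      = 0
coareaFrom i e (N ∷ p) = (i ∸ e) + coareaFrom (suc i) e p
coareaFrom i e (E ∷ p) = coareaFrom i (suc e) p

coarea : List Step → ℕ
coarea = coareaFrom 0 0

qCatalan : ℕ → ℚ → ℚ
qCatalan n q = sumℚ (map (λ p → q ^ℚ coarea p) (dyckPaths n))

-- Partitions, as the list of their nonzero parts (λ₁, …, λ_k)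

isPartition : List ℕ → Bool
isPartition []            = true
isPartition (a ∷ [])      = 1 ≤ᵇ a
isPartition (a ∷ b ∷ rest) = (b ≤ᵇ a) ∧ isPartition (b ∷ rest)

-- λ_i (1-indexed), with λ_i = 0 for i > k
part : List ℕ → ℕ → ℕ
part []      _             = 0
part (a ∷ _) (suc zero)    = a
part (_ ∷ l) (suc (suc i)) = part l (suc i)
part _       zero          = 0

size : List ℕ → ℕ
size = foldr _+_ 0

boundedLists : ℕ → ℕ → List (List ℕ)
boundedLists b zero    = [] ∷ []
boundedLists b (suc m) =
  [] ∷ concatMap (λ a → map (suc a ∷_) (boundedLists b m)) (upTo b)

-- all partitions λ (including the empty one) with λ₁ + k ≤ n, each once.
-- (Such λ has k ≤ n and all parts ≤ n, so it occurs in boundedLists n n.)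
partitionsFor : ℕ → List (List ℕ)
partitionsFor n =
  bfilter (λ l → isPartition l ∧ ((part l 1 + length l) ≤ᵇ n))
             (boundedLists n n)

-- ∏_{i ≥ 1} binom(λ_i − λ_{i+2} + 1, λ_{i+1} − λ_{i+2});
-- factors with i > k equal binom(1,0) = 1, so i ranges over 1..k+1.
weight : List ℕ → ℕ
weight l = prodℕ (map (λ j → let i = suc j in
  ((part l i ∸ part l (i + 2)) + 1) C (part l (i + 1) ∸ part l (i + 2)))
  (upTo (suc (length l))))

rhs : ℕ → ℚ → ℚ
rhs n q = sumℚ (map (λ l → ((+ weight l) Q./ 1) Q.* (q ^ℚ ((part l 1 C 2) + size l)))
                    (partitionsFor n))

module Submission where

open import Defs
open import Data.Nat using (ℕ; _≥_)
open import Data.Nat.Combinatorics using (_C_)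
open import Data.Rational using (ℚ; NonZero; 1/_)
open import Relation.Binary.PropositionalEquality using (_≡_)

-- Put x = 1/q.  Read step by step, a north step of a Dyck path taken
-- at height h (its distance from the diagonal) adds h unit squares to
-- the coarea, so C_n(x) is a transfer-matrix sum (walkSum), which we
-- refine by the number of visits to a cap height (capped).  The key
-- fact is peak insertion: a walk under the cap H + 1 touching it c
-- times is a walk under the cap H, touching it v times, with c peaks
-- inserted into its slots on level H, and these insertions are counted
-- by binomial coefficients.  Sorting the Dyck paths of semilength n by
-- their height n - z and peeling off the top levels one at a time
-- (expandTop) identifies them with the partitions λ = (z, r₁, r₂, …)
-- with at most n - z parts: the visit counts determine the parts and
-- the insertion counts give the factors of Defs.weight.

open import Algebra.Bundles using (CommutativeMonoid)
import Algebra.Properties.CommutativeSemigroup as CommSemigroupProperties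
open import Data.Bool using (Bool; true; false; T; _∧_; if_then_else_)
import Data.Bool.Properties as BP
open import Data.Empty using (⊥; ⊥-elim)
import Data.Integer as ℤ
import Data.Integer.Properties as ℤP
open import Data.List using (List; []; _∷_; _++_; length; map; concatMap; applyUpTo; upTo)
open import Data.List.Properties using (map-++; map-∘; map-applyUpTo)
open import Data.Nat as ℕ using (zero; suc; _+_; _*_; _∸_; _≤_; _<_; z≤n; s≤s; _≤ᵇ_)
open import Data.Nat.Combinatorics
  using (nCk+nC[k+1]≡[n+1]C[k+1]; nCk≡nC[n∸k]; k>n⇒nCk≡0; nCn≡1; nC1≡n)
import Data.Nat.Properties as ℕP
import Data.Nat.Solver as ℕSolver
open import Data.Product using (_×_; _,_)
open import Data.Rational as Q using (0ℚ; 1ℚ) renaming (_+_ to _+q_; _*_ to _*q_)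
import Data.Rational.Properties as QP
import Data.Rational.Solver as QSolver
import Data.Rational.Unnormalised as U
import Data.Rational.Unnormalised.Properties as UP
open import Data.Unit using (⊤; tt)
open import Function using (_∘_)
open import Function.Bundles using (Equivalence)
open import Relation.Binary.PropositionalEquality
  using (refl; sym; trans; cong; cong₂; subst; module ≡-Reasoning)
open import Relation.Nullary using (yes; no)

open ≡-Reasoning

open CommSemigroupProperties (CommutativeMonoid.commutativeSemigroup QP.+-0-commutativeMonoid)
  using () renaming (interchange to +q-interchange)
open CommSemigroupProperties (CommutativeMonoid.commutativeSemigroup QP.*-1-commutativeMonoid)
  using () renaming (interchange to *q-interchange; x∙yz≈y∙xz to *q-exchange)

ι : ℕ → ℚ
ι k = (ℤ.+ k) Q./ 1

private
  ιᵘ : ℕ → U.ℚᵘ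
  ιᵘ k = U.mkℚᵘ (ℤ.+ k) 0

  toℚᵘ-ι : ∀ k → Q.toℚᵘ (ι k) U.≃ ιᵘ k
  toℚᵘ-ι k = QP.toℚᵘ-fromℚᵘ (ιᵘ k)

  ιᵘ-+ : ∀ m n → ιᵘ m U.+ ιᵘ n U.≃ ιᵘ (m + n)
  ιᵘ-+ m n = U.*≡* (trans (ℤP.*-identityʳ _)
    (trans (cong₂ ℤ._+_ (ℤP.*-identityʳ (ℤ.+ m)) (ℤP.*-identityʳ (ℤ.+ n)))
           (sym (trans (ℤP.*-identityʳ _) (ℤP.pos-+ m n)))))

  ιᵘ-* : ∀ m n → ιᵘ m U.* ιᵘ n U.≃ ιᵘ (m * n)
  ιᵘ-* m n = U.*≡* (trans (ℤP.*-identityʳ _) (sym (trans (ℤP.*-identityʳ _) (ℤP.pos-* m n))))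

ι-+ : ∀ m n → ι (m + n) ≡ ι m +q ι n
ι-+ m n = QP.toℚᵘ-injective (UP.≃-trans (toℚᵘ-ι (m + n)) (UP.≃-sym
  (UP.≃-trans (QP.toℚᵘ-homo-+ (ι m) (ι n))
    (UP.≃-trans (UP.+-cong (toℚᵘ-ι m) (toℚᵘ-ι n)) (ιᵘ-+ m n)))))

ι-* : ∀ m n → ι (m * n) ≡ ι m *q ι n
ι-* m n = QP.toℚᵘ-injective (UP.≃-trans (toℚᵘ-ι (m * n)) (UP.≃-sym
  (UP.≃-trans (QP.toℚᵘ-homo-* (ι m) (ι n))
    (UP.≃-trans (UP.*-cong (toℚᵘ-ι m) (toℚᵘ-ι n)) (ιᵘ-* m n)))))

^ℚ-+ : ∀ x m n → x ^ℚ (m + n) ≡ x ^ℚ m *q x ^ℚ n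
^ℚ-+ x zero    n = sym (QP.*-identityˡ _)
^ℚ-+ x (suc m) n = trans (cong (x *q_) (^ℚ-+ x m n)) (sym (QP.*-assoc x _ _))

-- q^e · (1/q)^e = 1; this cancels the substitution x = 1/q at the end.
^ℚ-inverse : ∀ q .{{_ : NonZero q}} e → q ^ℚ e *q (1/ q) ^ℚ e ≡ 1ℚ
^ℚ-inverse q zero    = refl
^ℚ-inverse q (suc e) = begin
  (q *q q ^ℚ e) *q (1/ q *q (1/ q) ^ℚ e)  ≡⟨ *q-interchange q (q ^ℚ e) (1/ q) _ ⟩
  (q *q 1/ q) *q (q ^ℚ e *q (1/ q) ^ℚ e)  ≡⟨ cong₂ _*q_ (QP.*-inverseʳ q) (^ℚ-inverse q e) ⟩
  1ℚ *q 1ℚ                                ≡⟨⟩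
  1ℚ                                      ∎

∑ : ℕ → (ℕ → ℚ) → ℚ
∑ zero    f = 0ℚ
∑ (suc n) f = f 0 +q ∑ n (f ∘ suc)

∑-cong : ∀ n {f g : ℕ → ℚ} → (∀ i → i < n → f i ≡ g i) → ∑ n f ≡ ∑ n g
∑-cong zero    h = refl
∑-cong (suc n) h = cong₂ _+q_ (h 0 (s≤s z≤n)) (∑-cong n (λ i i<n → h (suc i) (s≤s i<n)))

∑-ext : ∀ n {f g : ℕ → ℚ} → (∀ i → f i ≡ g i) → ∑ n f ≡ ∑ n g
∑-ext n h = ∑-cong n (λ i _ → h i)

∑-zero : ∀ n {f : ℕ → ℚ} → (∀ i → i < n → f i ≡ 0ℚ) → ∑ n f ≡ 0ℚ
∑-zero zero    h = refl
∑-zero (suc n) h = trans (cong₂ _+q_ (h 0 (s≤s z≤n)) (∑-zero n (λ i i<n → h (suc i) (s≤s i<n))))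
                         (QP.+-identityˡ 0ℚ)

∑-+ : ∀ n (f g : ℕ → ℚ) → ∑ n (λ i → f i +q g i) ≡ ∑ n f +q ∑ n g
∑-+ zero    f g = sym (QP.+-identityˡ 0ℚ)
∑-+ (suc n) f g = trans (cong ((f 0 +q g 0) +q_) (∑-+ n (f ∘ suc) (g ∘ suc)))
                        (+q-interchange (f 0) (g 0) _ _)

∑-*ˡ : ∀ n k (f : ℕ → ℚ) → k *q ∑ n f ≡ ∑ n (λ i → k *q f i)
∑-*ˡ zero    k f = QP.*-zeroʳ k
∑-*ˡ (suc n) k f = trans (QP.*-distribˡ-+ k (f 0) _) (cong ((k *q f 0) +q_) (∑-*ˡ n k (f ∘ suc)))

∑-last : ∀ n (f : ℕ → ℚ) → ∑ (suc n) f ≡ ∑ n f +q f n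
∑-last zero    f = trans (QP.+-identityʳ (f 0)) (sym (QP.+-identityˡ (f 0)))
∑-last (suc n) f = trans (cong (f 0 +q_) (∑-last n (f ∘ suc))) (sym (QP.+-assoc (f 0) _ _))

∑-trim : ∀ m n (f : ℕ → ℚ) → m ≤ n → (∀ i → m ≤ i → i < n → f i ≡ 0ℚ) → ∑ n f ≡ ∑ m f
∑-trim zero    n       f _         h = ∑-zero n (λ i i<n → h i z≤n i<n)
∑-trim (suc m) (suc n) f (s≤s m≤n) h =
  cong (f 0 +q_) (∑-trim m n (f ∘ suc) m≤n (λ i m≤i i<n → h (suc i) (s≤s m≤i) (s≤s i<n)))

∑-reverse : ∀ n (f : ℕ → ℚ) → ∑ n (λ i → f (n ∸ suc i)) ≡ ∑ n f
∑-reverse zero    f = refl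
∑-reverse (suc n) f =
  trans (cong (f n +q_) (∑-reverse n f)) (trans (QP.+-comm (f n) _) (sym (∑-last n f)))

sumℚ-++ : ∀ xs ys → sumℚ (xs ++ ys) ≡ sumℚ xs +q sumℚ ys
sumℚ-++ []       ys = sym (QP.+-identityˡ _)
sumℚ-++ (x ∷ xs) ys = trans (cong (x +q_) (sumℚ-++ xs ys)) (sym (QP.+-assoc x _ _))

sumℚ-cong : ∀ {A : Set} {f g : A → ℚ} xs → (∀ y → f y ≡ g y) → sumℚ (map f xs) ≡ sumℚ (map g xs)
sumℚ-cong []       h = refl
sumℚ-cong (y ∷ ys) h = cong₂ _+q_ (h y) (sumℚ-cong ys h)

sumℚ-zero : ∀ {A : Set} {f : A → ℚ} xs → (∀ y → f y ≡ 0ℚ) → sumℚ (map f xs) ≡ 0ℚ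
sumℚ-zero []       h = refl
sumℚ-zero (y ∷ ys) h = trans (cong₂ _+q_ (h y) (sumℚ-zero ys h)) (QP.+-identityˡ 0ℚ)

sumℚ-+ : ∀ {A : Set} (f g : A → ℚ) xs →
         sumℚ (map (λ y → f y +q g y) xs) ≡ sumℚ (map f xs) +q sumℚ (map g xs)
sumℚ-+ f g []       = sym (QP.+-identityˡ 0ℚ)
sumℚ-+ f g (y ∷ ys) = trans (cong ((f y +q g y) +q_) (sumℚ-+ f g ys)) (+q-interchange (f y) (g y) _ _)

sumℚ-*ˡ : ∀ {A : Set} k (f : A → ℚ) xs → sumℚ (map (λ y → k *q f y) xs) ≡ k *q sumℚ (map f xs)
sumℚ-*ˡ k f []       = sym (QP.*-zeroʳ k)
sumℚ-*ˡ k f (y ∷ ys) = trans (cong ((k *q f y) +q_) (sumℚ-*ˡ k f ys)) (sym (QP.*-distribˡ-+ k (f y) _))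

sumℚ-concatMap : ∀ {A B : Set} (f : B → ℚ) (g : A → List B) xs →
  sumℚ (map f (concatMap g xs)) ≡ sumℚ (map (λ y → sumℚ (map f (g y))) xs)
sumℚ-concatMap f g []       = refl
sumℚ-concatMap f g (y ∷ ys) = begin
  sumℚ (map f (g y ++ concatMap g ys))               ≡⟨ cong sumℚ (map-++ f (g y) _) ⟩
  sumℚ (map f (g y) ++ map f (concatMap g ys))        ≡⟨ sumℚ-++ (map f (g y)) _ ⟩
  sumℚ (map f (g y)) +q sumℚ (map f (concatMap g ys)) ≡⟨ cong (sumℚ (map f (g y)) +q_) (sumℚ-concatMap f g ys) ⟩
  sumℚ (map (λ y → sumℚ (map f (g y))) (y ∷ ys))     ∎

sumℚ-bfilter : ∀ {A : Set} (p : A → Bool) (f : A → ℚ) xs →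
  sumℚ (map f (bfilter p xs)) ≡ sumℚ (map (λ y → if p y then f y else 0ℚ) xs)
sumℚ-bfilter p f []       = refl
sumℚ-bfilter p f (y ∷ ys) with p y
... | true  = cong (f y +q_) (sumℚ-bfilter p f ys)
... | false = trans (sumℚ-bfilter p f ys) (sym (QP.+-identityˡ _))

sumℚ-upTo : ∀ (g : ℕ → ℚ) n → sumℚ (map g (upTo n)) ≡ ∑ n g
sumℚ-upTo g n = trans (cong sumℚ (map-applyUpTo (λ i → i) g n)) (go g n)
  where
  go : ∀ (g : ℕ → ℚ) n → sumℚ (applyUpTo g n) ≡ ∑ n g
  go g zero    = refl
  go g (suc n) = cong (g 0 +q_) (go (g ∘ suc) n)

[m+n]C2 : ∀ m n → (m + n) C 2 ≡ m C 2 + n C 2 + m * n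
[m+n]C2 zero    n = sym (ℕP.+-identityʳ (n C 2))
[m+n]C2 (suc m) n = begin
  suc (m + n) C 2                     ≡⟨ sym (nCk+nC[k+1]≡[n+1]C[k+1] (m + n) 1) ⟩
  (m + n) C 1 + (m + n) C 2           ≡⟨ cong₂ _+_ (nC1≡n (m + n)) ([m+n]C2 m n) ⟩
  (m + n) + (m C 2 + n C 2 + m * n)   ≡⟨ rearrange m n (m C 2) (n C 2) ⟩
  (m + m C 2) + n C 2 + suc m * n     ≡⟨ cong (λ t → t + n C 2 + suc m * n)
                                           (trans (cong (_+ m C 2) (sym (nC1≡n m)))
                                                  (nCk+nC[k+1]≡[n+1]C[k+1] m 1)) ⟩
  suc m C 2 + n C 2 + suc m * n       ∎
  where
  open ℕSolver.+-*-Solver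
  rearrange : ∀ m n a b → (m + n) + (a + b + m * n) ≡ (m + a) + b + suc m * n
  rearrange = solve 4 (λ m n a b → (m :+ n) :+ (a :+ b :+ m :* n)
                                 := (m :+ a) :+ b :+ (con 1 :+ m) :* n) refl

-- c < c + 1 in the shape c + a, a = 0, arising from the walk arguments.
c+0<1+c : ∀ c → c + 0 < suc c
c+0<1+c c = s≤s (ℕP.≤-reflexive (ℕP.+-identityʳ c))

≤ᵇ-true : ∀ {m n} → m ≤ n → (m ≤ᵇ n) ≡ true
≤ᵇ-true m≤n = Equivalence.to BP.T-≡ (ℕP.≤⇒≤ᵇ m≤n)

≤ᵇ-false : ∀ {m n} → n < m → (m ≤ᵇ n) ≡ false
≤ᵇ-false {m} {n} n<m with m ≤ᵇ n in eq
... | false = refl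
... | true  = ⊥-elim (ℕP.<⇒≱ n<m (ℕP.≤ᵇ⇒≤ m n (subst T (sym eq) tt)))

suc≤ᵇsuc : ∀ m n → (suc m ≤ᵇ suc n) ≡ (m ≤ᵇ n)
suc≤ᵇsuc zero    n = refl
suc≤ᵇsuc (suc m) n = refl

+-≤ᵇ : ∀ k m n → (k + m ≤ᵇ k + n) ≡ (m ≤ᵇ n)
+-≤ᵇ zero    m n = refl
+-≤ᵇ (suc k) m n = trans (suc≤ᵇsuc (k + m) (k + n)) (+-≤ᵇ k m n)

dyckFrom-noNorth : ∀ h b p → dyckFrom h zero b (N ∷ p) ≡ false
dyckFrom-noNorth zero    zero    p = refl
dyckFrom-noNorth (suc h) zero    p = refl
dyckFrom-noNorth zero    (suc b) p = refl
dyckFrom-noNorth (suc h) (suc b) p = refl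

dyckFrom-floor : ∀ a b p → dyckFrom zero a b (E ∷ p) ≡ false
dyckFrom-floor zero    zero    p = refl
dyckFrom-floor zero    (suc b) p = refl
dyckFrom-floor (suc a) b       p = refl

dyckFrom-noEast : ∀ h a p → dyckFrom (suc h) a zero (E ∷ p) ≡ false
dyckFrom-noEast h zero    p = refl
dyckFrom-noEast h (suc a) p = refl

dyckFrom-east : ∀ h a b p → dyckFrom (suc h) a (suc b) (E ∷ p) ≡ dyckFrom h a b p
dyckFrom-east h zero    b p = refl
dyckFrom-east h (suc a) b p = refl

sumℚ-allPaths-suc : ∀ (f : List Step → ℚ) s →
  sumℚ (map f (allPaths (suc s)))
    ≡ sumℚ (map (λ p → f (N ∷ p)) (allPaths s)) +q sumℚ (map (λ p → f (E ∷ p)) (allPaths s))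
sumℚ-allPaths-suc f s = begin
  sumℚ (map f (allPaths (suc s)))
    ≡⟨ sumℚ-concatMap f (λ p → (N ∷ p) ∷ (E ∷ p) ∷ []) (allPaths s) ⟩
  sumℚ (map (λ p → f (N ∷ p) +q (f (E ∷ p) +q 0ℚ)) (allPaths s))
    ≡⟨ sumℚ-cong (allPaths s) (λ p → cong (f (N ∷ p) +q_) (QP.+-identityʳ _)) ⟩
  sumℚ (map (λ p → f (N ∷ p) +q f (E ∷ p)) (allPaths s))
    ≡⟨ sumℚ-+ (λ p → f (N ∷ p)) (λ p → f (E ∷ p)) (allPaths s) ⟩
  sumℚ (map (λ p → f (N ∷ p)) (allPaths s)) +q sumℚ (map (λ p → f (E ∷ p)) (allPaths s)) ∎

module Paths (x : ℚ) where

  -- Walk sums.  A north step taken at height h (i.e. in a row whose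
  -- north step lies h columns left of the diagonal) contributes h
  -- squares to the coarea, hence a factor x^h.

  -- walkSum s h a b: total weight of the step sequences of length s
  -- that, started at height h with a north and b east steps still to
  -- be used, never go below height 0.
  mutual
    walkSum : ℕ → ℕ → ℕ → ℕ → ℚ
    walkSum zero    h zero    zero    = 1ℚ
    walkSum zero    h zero    (suc b) = 0ℚ
    walkSum zero    h (suc a) b       = 0ℚ
    walkSum (suc s) h a       b       = northWalk s h a b +q eastWalk s h a b

    northWalk : ℕ → ℕ → ℕ → ℕ → ℚ
    northWalk s h zero    b = 0ℚ
    northWalk s h (suc a) b = x ^ℚ h *q walkSum s (suc h) a b

    eastWalk : ℕ → ℕ → ℕ → ℕ → ℚ
    eastWalk s zero    a b       = 0ℚ
    eastWalk s (suc h) a zero    = 0ℚ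
    eastWalk s (suc h) a (suc b) = walkSum s h a b

  -- The summand of Defs.qCatalan for a suffix p read from height h
  -- after e east steps (so in row e + h).
  pathWeight : ℕ → ℕ → ℕ → ℕ → List Step → ℚ
  pathWeight h a b e p = if dyckFrom h a b p then x ^ℚ coareaFrom (e + h) e p else 0ℚ

  pathWeight-empty : ∀ h a b e → pathWeight h a b e [] ≡ walkSum zero h a b
  pathWeight-empty h       zero    zero    e = refl
  pathWeight-empty zero    zero    (suc b) e = refl
  pathWeight-empty (suc h) zero    (suc b) e = refl
  pathWeight-empty zero    (suc a) b       e = refl
  pathWeight-empty (suc h) (suc a) zero    e = refl
  pathWeight-empty (suc h) (suc a) (suc b) e = refl

  pathWeight-north : ∀ h a b e p →
    pathWeight h (suc a) b e (N ∷ p) ≡ x ^ℚ h *q pathWeight (suc h) a b e p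
  pathWeight-north h a b e p with dyckFrom (suc h) a b p
  ... | false = sym (QP.*-zeroʳ (x ^ℚ h))
  ... | true  = begin
    x ^ℚ ((e + h ∸ e) + coareaFrom (suc (e + h)) e p) ≡⟨ cong₂ (λ i j → x ^ℚ (i + coareaFrom j e p))
                                                            (ℕP.m+n∸m≡n e h) (sym (ℕP.+-suc e h)) ⟩
    x ^ℚ (h + coareaFrom (e + suc h) e p)             ≡⟨ ^ℚ-+ x h _ ⟩
    x ^ℚ h *q x ^ℚ coareaFrom (e + suc h) e p         ∎

  pathWeight-east : ∀ h a b e p → pathWeight (suc h) a (suc b) e (E ∷ p) ≡ pathWeight h a b (suc e) p
  pathWeight-east h a b e p = cong₂ (λ ok i → if ok then x ^ℚ coareaFrom i (suc e) p else 0ℚ)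
                                    (dyckFrom-east h a b p) (ℕP.+-suc e h)

  pathWeight-dead : ∀ h a b e p → dyckFrom h a b p ≡ false → pathWeight h a b e p ≡ 0ℚ
  pathWeight-dead h a b e p dead = cong (λ ok → if ok then _ else 0ℚ) dead

  allPaths-walkSum : ∀ s h a b e → sumℚ (map (pathWeight h a b e) (allPaths s)) ≡ walkSum s h a b
  allPaths-walkSum zero    h a b e = trans (QP.+-identityʳ _) (pathWeight-empty h a b e)
  allPaths-walkSum (suc s) h a b e =
    trans (sumℚ-allPaths-suc (pathWeight h a b e) s) (cong₂ _+q_ (north a) (east h b))
    where
    north : ∀ a → sumℚ (map (λ p → pathWeight h a b e (N ∷ p)) (allPaths s)) ≡ northWalk s h a b
    north zero    = sumℚ-zero (allPaths s) (λ p → pathWeight-dead h 0 b e (N ∷ p) (dyckFrom-noNorth h b p))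
    north (suc a) = begin
      sumℚ (map (λ p → pathWeight h (suc a) b e (N ∷ p)) (allPaths s))
        ≡⟨ sumℚ-cong (allPaths s) (pathWeight-north h a b e) ⟩
      sumℚ (map (λ p → x ^ℚ h *q pathWeight (suc h) a b e p) (allPaths s))
        ≡⟨ sumℚ-*ˡ (x ^ℚ h) (pathWeight (suc h) a b e) (allPaths s) ⟩
      x ^ℚ h *q sumℚ (map (pathWeight (suc h) a b e) (allPaths s))
        ≡⟨ cong (x ^ℚ h *q_) (allPaths-walkSum s (suc h) a b e) ⟩
      x ^ℚ h *q walkSum s (suc h) a b ∎
    east : ∀ h b → sumℚ (map (λ p → pathWeight h a b e (E ∷ p)) (allPaths s)) ≡ eastWalk s h a b
    east zero    b       = sumℚ-zero (allPaths s) (λ p → pathWeight-dead 0 a b e (E ∷ p) (dyckFrom-floor a b p))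
    east (suc h) zero    = sumℚ-zero (allPaths s) (λ p → pathWeight-dead (suc h) a 0 e (E ∷ p) (dyckFrom-noEast h a p))
    east (suc h) (suc b) = trans (sumℚ-cong (allPaths s) (pathWeight-east h a b e)) (allPaths-walkSum s h a b (suc e))

  stop : ℕ → ℕ → ℕ → ℕ → ℚ
  stop (suc e) c       a       b       = 0ℚ
  stop zero    (suc c) a       b       = 0ℚ
  stop zero    zero    (suc a) b       = 0ℚ
  stop zero    zero    zero    (suc b) = 0ℚ
  stop zero    zero    zero    zero    = 1ℚ

  -- capped g e c a b: weight of the walks from height e with a north
  -- and b east steps left that end at height 0, never rise above the
  -- cap e + g, and make exactly c north steps onto the cap.
  mutual
    capped : ℕ → ℕ → ℕ → ℕ → ℕ → ℚ
    capped g e c a b = stop e c a b +q (cappedNorth g e c a b +q cappedEast g e c a b)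

    cappedNorth : ℕ → ℕ → ℕ → ℕ → ℕ → ℚ
    cappedNorth zero          e c       a       b = 0ℚ
    cappedNorth (suc g)       e c       zero    b = 0ℚ
    cappedNorth (suc zero)    e zero    (suc a) b = 0ℚ
    cappedNorth (suc zero)    e (suc c) (suc a) b = x ^ℚ e *q capped zero (suc e) c a b
    cappedNorth (suc (suc g)) e c       (suc a) b = x ^ℚ e *q capped (suc g) (suc e) c a b

    cappedEast : ℕ → ℕ → ℕ → ℕ → ℕ → ℚ
    cappedEast g zero    c a b       = 0ℚ
    cappedEast g (suc e) c a zero    = 0ℚ
    cappedEast g (suc e) c a (suc b) = capped (suc g) e c a b

  stop-visit : ∀ e c a b → stop e (suc c) a b ≡ 0ℚ
  stop-visit zero    c a b = refl
  stop-visit (suc e) c a b = refl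

  stop-north : ∀ e c a b → stop e c (suc a) b ≡ 0ℚ
  stop-north zero    zero    a b = refl
  stop-north zero    (suc c) a b = refl
  stop-north (suc e) c       a b = refl

  stop-east : ∀ e c a b → stop e c a (suc b) ≡ 0ℚ
  stop-east zero    zero    zero    b = refl
  stop-east zero    zero    (suc a) b = refl
  stop-east zero    (suc c) a       b = refl
  stop-east (suc e) c       a       b = refl

  -- On the cap (room 0, positive height) the walk has to step east.
  capped-onCap : ∀ e c a b → capped zero (suc e) c a (suc b) ≡ capped 1 e c a b
  capped-onCap e c a b = trans (QP.+-identityˡ _) (QP.+-identityˡ (capped 1 e c a b))

  cappedNorth-none : ∀ g e c b → cappedNorth g e c 0 b ≡ 0ℚ
  cappedNorth-none zero    e c b = refl
  cappedNorth-none (suc g) e c b = refl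

  ∑-capped : ∀ B g e a b → ∑ B (λ c → capped g e c a b)
    ≡ ∑ B (λ c → stop e c a b) +q (∑ B (λ c → cappedNorth g e c a b) +q ∑ B (λ c → cappedEast g e c a b))
  ∑-capped B g e a b =
    trans (∑-+ B (λ c → stop e c a b) (λ c → cappedNorth g e c a b +q cappedEast g e c a b))
          (cong (∑ B (λ c → stop e c a b) +q_) (∑-+ B (λ c → cappedNorth g e c a b) (λ c → cappedEast g e c a b)))

  -- A walk ending at height 0 that has at most g north steps left can
  -- never exceed the cap e + g, so summing over all visit counts below
  -- B > a recovers the walk sum.
  walkSum-capped : ∀ s h a b g B → s ≡ a + b → b ≡ a + h → a ≤ g → a < B →
                   walkSum s h a b ≡ ∑ B (λ c → capped g h c a b)
  walkSum-capped zero zero zero zero g (suc B) _ _ _ _ = sym (begin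
    ∑ (suc B) (λ c → capped g 0 c 0 0)
      ≡⟨ cong₂ _+q_ (cong (λ t → 1ℚ +q (t +q 0ℚ)) (cappedNorth-none g 0 0 0))
                    (∑-zero B (λ c _ → cong (λ t → 0ℚ +q (t +q 0ℚ)) (cappedNorth-none g 0 (suc c) 0))) ⟩
    1ℚ +q 0ℚ ≡⟨⟩
    1ℚ ∎)
  walkSum-capped zero (suc h) zero    zero    g B _  () _ _
  walkSum-capped zero h       zero    (suc b) g B () _  _ _
  walkSum-capped zero h       (suc a) b       g B () _  _ _
  walkSum-capped (suc s) h a b g B s≡ b≡ a≤g a<B = sym (begin
    ∑ B (λ c → capped g h c a b)
      ≡⟨ ∑-capped B g h a b ⟩
    ∑ B (λ c → stop h c a b) +q (∑ B (λ c → cappedNorth g h c a b) +q ∑ B (λ c → cappedEast g h c a b))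
      ≡⟨ cong (_+q (∑ B (λ c → cappedNorth g h c a b) +q ∑ B (λ c → cappedEast g h c a b)))
              (∑-zero B (λ c _ → notStopped a b s≡)) ⟩
    0ℚ +q (∑ B (λ c → cappedNorth g h c a b) +q ∑ B (λ c → cappedEast g h c a b))
      ≡⟨ QP.+-identityˡ _ ⟩
    ∑ B (λ c → cappedNorth g h c a b) +q ∑ B (λ c → cappedEast g h c a b)
      ≡⟨ sym (cong₂ _+q_ (north a g s≡ b≡ a≤g a<B) (east h b s≡ b≡)) ⟩
    northWalk s h a b +q eastWalk s h a b ∎)
    where
    notStopped : ∀ a b → suc s ≡ a + b → ∀ {c} → stop h c a b ≡ 0ℚ
    notStopped zero    zero    ()
    notStopped zero    (suc b) _ {c} = stop-east h c 0 b
    notStopped (suc a) b       _ {c} = stop-north h c a b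
    north : ∀ a g → suc s ≡ a + b → b ≡ a + h → a ≤ g → a < B →
            northWalk s h a b ≡ ∑ B (λ c → cappedNorth g h c a b)
    north zero g _ _ _ _ = sym (∑-zero B (λ c _ → cappedNorth-none g h c b))
    north (suc zero) (suc zero) s≡ b≡ (s≤s z≤n) (s≤s (s≤s {n = B'} z≤n)) = begin
      x ^ℚ h *q walkSum s (suc h) 0 b
        ≡⟨ cong (x ^ℚ h *q_)
                (walkSum-capped s (suc h) 0 b 0 (suc B') (ℕP.suc-injective s≡) b≡ z≤n (s≤s z≤n)) ⟩
      x ^ℚ h *q ∑ (suc B') (λ c → capped 0 (suc h) c 0 b)
        ≡⟨ ∑-*ˡ (suc B') (x ^ℚ h) (λ c → capped 0 (suc h) c 0 b) ⟩
      ∑ (suc B') (λ c → x ^ℚ h *q capped 0 (suc h) c 0 b)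
        ≡⟨ sym (QP.+-identityˡ _) ⟩
      ∑ (suc (suc B')) (λ c → cappedNorth 1 h c 1 b) ∎
    north (suc a) (suc (suc g)) s≡ b≡ (s≤s a≤g) a<B =
      trans (cong (x ^ℚ h *q_)
                  (walkSum-capped s (suc h) a b (suc g) B (ℕP.suc-injective s≡)
                                  (trans b≡ (sym (ℕP.+-suc a h))) a≤g (ℕP.<-trans (ℕP.n<1+n a) a<B)))
            (∑-*ˡ B (x ^ℚ h) (λ c → capped (suc g) (suc h) c a b))
    east : ∀ h b → suc s ≡ a + b → b ≡ a + h → eastWalk s h a b ≡ ∑ B (λ c → cappedEast g h c a b)
    east zero    b       _  _  = sym (∑-zero B (λ c _ → refl))
    east (suc h) zero    _  _  = sym (∑-zero B (λ c _ → refl))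
    east (suc h) (suc b) s≡ b≡ =
      walkSum-capped s h a b (suc g) B (ℕP.suc-injective (trans s≡ (ℕP.+-suc a b)))
                     (ℕP.suc-injective (trans b≡ (ℕP.+-suc a h))) (ℕP.m≤n⇒m≤1+n a≤g) a<B

  capped-fewNorth : ∀ g e c a b → a < c → capped g e c a b ≡ 0ℚ
  capped-fewNorth g e (suc c) a b a<c =
    cong₂ _+q_ (stop-visit e c a b) (cong₂ _+q_ (north g a a<c) (east e b))
    where
    north : ∀ g a → a < suc c → cappedNorth g e (suc c) a b ≡ 0ℚ
    north zero          a       _         = refl
    north (suc g)       zero    _         = refl
    north (suc zero)    (suc a) (s≤s a<c) =
      trans (cong (x ^ℚ e *q_) (capped-fewNorth zero (suc e) c a b a<c)) (QP.*-zeroʳ (x ^ℚ e))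
    north (suc (suc g)) (suc a) a<c       =
      trans (cong (x ^ℚ e *q_) (capped-fewNorth (suc g) (suc e) (suc c) a b (ℕP.<-trans (ℕP.n<1+n a) a<c)))
            (QP.*-zeroʳ (x ^ℚ e))
    east : ∀ e b → cappedEast g e (suc c) a b ≡ 0ℚ
    east zero    b       = refl
    east (suc e) zero    = refl
    east (suc e) (suc b) = capped-fewNorth (suc g) e (suc c) a b a<c

  mutual
    capped-fewEast : ∀ g e c a b → b < c → capped g e c a b ≡ 0ℚ
    capped-fewEast g e (suc c) a b b<c =
      cong₂ _+q_ (stop-visit e c a b) (cong₂ _+q_ (north g a) (east e b b<c))
      where
      north : ∀ g a → cappedNorth g e (suc c) a b ≡ 0ℚ
      north zero          a       = refl
      north (suc g)       zero    = refl
      north (suc zero)    (suc a) =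
        trans (cong (x ^ℚ e *q_) (atCap-fewEast e c a b (ℕP.≤-pred b<c))) (QP.*-zeroʳ (x ^ℚ e))
      north (suc (suc g)) (suc a) =
        trans (cong (x ^ℚ e *q_) (capped-fewEast (suc g) (suc e) (suc c) a b b<c)) (QP.*-zeroʳ (x ^ℚ e))
      east : ∀ e b → b < suc c → cappedEast g e (suc c) a b ≡ 0ℚ
      east zero    b       _   = refl
      east (suc e) zero    _   = refl
      east (suc e) (suc b) b<c = capped-fewEast (suc g) e (suc c) a b (ℕP.<-trans (ℕP.n<1+n b) b<c)

    atCap-fewEast : ∀ e c a b → b ≤ c → capped zero (suc e) c a b ≡ 0ℚ
    atCap-fewEast e c a zero    _   = refl
    atCap-fewEast e c a (suc b) b≤c = trans (capped-onCap e c a b) (capped-fewEast 1 e c a b b≤c)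

  -- Lowering the cap of a walk by one deletes its c
  -- peaks on the cap; conversely a walk under cap e + g with v visits
  -- to that cap is completed to a walk under cap e + g + 1 with c
  -- visits by inserting c peaks NE into slots at the old cap, each
  -- contributing x^(g+e).

  -- Number of ways to place c peaks into the slots: when the walk
  -- starts on the cap (room 0) there are v + 1 slots, otherwise v.
  insertions : ℕ → ℕ → ℕ → ℕ
  insertions zero    v c = (v + c) C c
  insertions (suc g) v c = (v + c ∸ 1) C c

  -- withPeaks g e c B F: the values F v (v < B visits to the old cap)
  -- weighted by the ways to insert c peaks and by the peaks' x^((g+e)c).
  withPeaks : ℕ → ℕ → ℕ → ℕ → (ℕ → ℚ) → ℚ
  withPeaks g e c B F = x ^ℚ ((g + e) * c) *q ∑ B (λ v → ι (insertions g v c) *q F v)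

  withPeaks-none : ∀ g e B F → withPeaks g e 0 B F ≡ ∑ B F
  withPeaks-none g e B F = begin
    x ^ℚ ((g + e) * 0) *q ∑ B (λ v → ι (insertions g v 0) *q F v)
      ≡⟨ cong₂ _*q_ (cong (x ^ℚ_) (ℕP.*-zeroʳ (g + e))) (∑-ext B (λ v → one g v)) ⟩
    1ℚ *q ∑ B F
      ≡⟨ QP.*-identityˡ _ ⟩
    ∑ B F ∎
    where
    one : ∀ g v → ι (insertions g v 0) *q F v ≡ F v
    one zero    v = QP.*-identityˡ (F v)
    one (suc g) v = QP.*-identityˡ (F v)

  withPeaks-vanish : ∀ g e c B F → (∀ v → ι (insertions g v c) *q F v ≡ 0ℚ) → withPeaks g e c B F ≡ 0ℚ
  withPeaks-vanish g e c B F h =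
    trans (cong (x ^ℚ ((g + e) * c) *q_) (∑-zero B (λ v _ → h v))) (QP.*-zeroʳ (x ^ℚ ((g + e) * c)))

  withPeaks-zero : ∀ g e c B F → (∀ v → F v ≡ 0ℚ) → withPeaks g e c B F ≡ 0ℚ
  withPeaks-zero g e c B F h =
    withPeaks-vanish g e c B F (λ v → trans (cong (ι (insertions g v c) *q_) (h v)) (QP.*-zeroʳ (ι (insertions g v c))))

  withPeaks-+ : ∀ g e c B F G → withPeaks g e c B (λ v → F v +q G v) ≡ withPeaks g e c B F +q withPeaks g e c B G
  withPeaks-+ g e c B F G = begin
    X *q ∑ B (λ v → k v *q (F v +q G v))
      ≡⟨ cong (X *q_) (∑-ext B (λ v → QP.*-distribˡ-+ (k v) (F v) (G v))) ⟩
    X *q ∑ B (λ v → k v *q F v +q k v *q G v)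
      ≡⟨ cong (X *q_) (∑-+ B (λ v → k v *q F v) (λ v → k v *q G v)) ⟩
    X *q (∑ B (λ v → k v *q F v) +q ∑ B (λ v → k v *q G v))
      ≡⟨ QP.*-distribˡ-+ X _ _ ⟩
    withPeaks g e c B F +q withPeaks g e c B G ∎
    where
    X = x ^ℚ ((g + e) * c)
    k = λ v → ι (insertions g v c)

  withPeaks-capped : ∀ g e c B a b →
    withPeaks g e c B (λ v → capped g e v a b)
      ≡ withPeaks g e c B (λ v → stop e v a b)
        +q (withPeaks g e c B (λ v → cappedNorth g e v a b) +q withPeaks g e c B (λ v → cappedEast g e v a b))
  withPeaks-capped g e c B a b =
    trans (withPeaks-+ g e c B (λ v → stop e v a b) (λ v → cappedNorth g e v a b +q cappedEast g e v a b))
          (cong (withPeaks g e c B (λ v → stop e v a b) +q_)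
                (withPeaks-+ g e c B (λ v → cappedNorth g e v a b) (λ v → cappedEast g e v a b)))

  ∑-stop : ∀ B e a b → ∑ (suc B) (λ v → stop e v a b) ≡ stop e 0 a b
  ∑-stop B e a b = trans (cong (stop e 0 a b +q_) (∑-zero B (λ v _ → stop-visit e v a b))) (QP.+-identityʳ _)

  pullNorth : ∀ e K B (k F : ℕ → ℚ) →
    x ^ℚ e *q (x ^ℚ K *q ∑ B (λ v → k v *q F v)) ≡ x ^ℚ K *q ∑ B (λ v → k v *q (x ^ℚ e *q F v))
  pullNorth e K B k F = begin
    x ^ℚ e *q (x ^ℚ K *q ∑ B (λ v → k v *q F v))
      ≡⟨ *q-exchange (x ^ℚ e) (x ^ℚ K) _ ⟩
    x ^ℚ K *q (x ^ℚ e *q ∑ B (λ v → k v *q F v))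
      ≡⟨ cong (x ^ℚ K *q_) (∑-*ˡ B (x ^ℚ e) (λ v → k v *q F v)) ⟩
    x ^ℚ K *q ∑ B (λ v → x ^ℚ e *q (k v *q F v))
      ≡⟨ cong (x ^ℚ K *q_) (∑-ext B (λ v → *q-exchange (x ^ℚ e) (k v) (F v))) ⟩
    x ^ℚ K *q ∑ B (λ v → k v *q (x ^ℚ e *q F v)) ∎

  capped-visiting : ∀ g e c a b → capped g e (suc c) a b ≡ cappedNorth g e (suc c) a b +q cappedEast g e (suc c) a b
  capped-visiting g e c a b =
    trans (cong (_+q (cappedNorth g e (suc c) a b +q cappedEast g e (suc c) a b)) (stop-visit e c a b))
          (QP.+-identityˡ _)

  -- The argument
  -- follows the first step of the walk; B is any bound beyond the
  -- number a of north steps left (hence beyond every possible v).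
  peakInsertion : ∀ g e c a b B → a < B →
    capped (suc g) e c (c + a) (c + b) ≡ withPeaks g e c B (λ v → capped g e v a b)
  -- Starting on the old cap with no peaks to insert: only east steps
  -- can leave the cap, after which the room is positive.
  peakInsertion zero e zero a b (suc B) a<B = sym (begin
    withPeaks 0 e 0 (suc B) (λ v → capped 0 e v a b)
      ≡⟨ withPeaks-none 0 e (suc B) (λ v → capped 0 e v a b) ⟩
    ∑ (suc B) (λ v → capped 0 e v a b)
      ≡⟨ ∑-capped (suc B) 0 e a b ⟩
    ∑ (suc B) (λ v → stop e v a b)
      +q (∑ (suc B) (λ v → cappedNorth 0 e v a b) +q ∑ (suc B) (λ v → cappedEast 0 e v a b))
      ≡⟨ cong₂ _+q_ (∑-stop B e a b)
                    (cong₂ _+q_ (trans (∑-zero (suc B) (λ v _ → refl)) (sym (noNorth a))) (sym (east e b))) ⟩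
    capped 1 e 0 a b ∎)
    where
    noNorth : ∀ a → cappedNorth 1 e 0 a b ≡ 0ℚ
    noNorth zero    = refl
    noNorth (suc a) = refl
    east : ∀ e b → cappedEast 1 e 0 a b ≡ ∑ (suc B) (λ v → cappedEast 0 e v a b)
    east zero    b       = sym (∑-zero (suc B) (λ v _ → refl))
    east (suc e) zero    = sym (∑-zero (suc B) (λ v _ → refl))
    east (suc e) (suc b) = trans (peakInsertion 1 e 0 a b (suc B) a<B)
                                 (withPeaks-none 1 e (suc B) (λ v → capped 1 e v a b))
  -- Starting on the old cap with c + 1 peaks to insert: either the
  -- first step is a new peak (Pascal's rule, lower term) or the first
  -- slot stays empty (upper term).
  peakInsertion zero e (suc c) a b B a<B = begin
    capped 1 e (suc c) (suc (c + a)) (suc (c + b))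
      ≡⟨ capped-visiting 1 e c (suc (c + a)) (suc (c + b)) ⟩
    cappedNorth 1 e (suc c) (suc (c + a)) (suc (c + b)) +q cappedEast 1 e (suc c) (suc (c + a)) (suc (c + b))
      ≡⟨ cong₂ _+q_ north (east e b) ⟩
    x ^ℚ (e * suc c) *q ∑ B lower +q x ^ℚ (e * suc c) *q ∑ B (upper e b)
      ≡⟨ sym (QP.*-distribˡ-+ (x ^ℚ (e * suc c)) _ _) ⟩
    x ^ℚ (e * suc c) *q (∑ B lower +q ∑ B (upper e b))
      ≡⟨ cong (x ^ℚ (e * suc c) *q_) (sym (∑-+ B lower (upper e b))) ⟩
    x ^ℚ (e * suc c) *q ∑ B (λ v → lower v +q upper e b v)
      ≡⟨ cong (x ^ℚ (e * suc c) *q_) (∑-ext B pascal) ⟩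
    withPeaks 0 e (suc c) B (λ v → capped 0 e v a b) ∎
    where
    lower : ℕ → ℚ
    lower v = ι ((v + c) C c) *q capped 0 e v a b
    upper : ℕ → ℕ → ℕ → ℚ
    upper e b v = ι ((v + c) C suc c) *q capped 0 e v a b
    pascal : ∀ v → lower v +q upper e b v ≡ ι ((v + suc c) C suc c) *q capped 0 e v a b
    pascal v = begin
      ι ((v + c) C c) *q capped 0 e v a b +q ι ((v + c) C suc c) *q capped 0 e v a b
        ≡⟨ sym (QP.*-distribʳ-+ (capped 0 e v a b) (ι ((v + c) C c)) (ι ((v + c) C suc c))) ⟩
      (ι ((v + c) C c) +q ι ((v + c) C suc c)) *q capped 0 e v a b
        ≡⟨ cong (_*q capped 0 e v a b) (sym (ι-+ ((v + c) C c) ((v + c) C suc c))) ⟩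
      ι ((v + c) C c + (v + c) C suc c) *q capped 0 e v a b
        ≡⟨ cong (λ t → ι t *q capped 0 e v a b)
                (trans (nCk+nC[k+1]≡[n+1]C[k+1] (v + c) c) (cong (_C suc c) (sym (ℕP.+-suc v c)))) ⟩
      ι ((v + suc c) C suc c) *q capped 0 e v a b ∎
    north : cappedNorth 1 e (suc c) (suc (c + a)) (suc (c + b)) ≡ x ^ℚ (e * suc c) *q ∑ B lower
    north = begin
      x ^ℚ e *q capped 0 (suc e) c (c + a) (suc (c + b))
        ≡⟨ cong (x ^ℚ e *q_) (trans (capped-onCap e c (c + a) (c + b)) (peakInsertion 0 e c a b B a<B)) ⟩
      x ^ℚ e *q (x ^ℚ (e * c) *q ∑ B lower)
        ≡⟨ sym (QP.*-assoc (x ^ℚ e) _ _) ⟩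
      (x ^ℚ e *q x ^ℚ (e * c)) *q ∑ B lower
        ≡⟨ cong (_*q ∑ B lower) (trans (sym (^ℚ-+ x e (e * c))) (cong (x ^ℚ_) (sym (ℕP.*-suc e c)))) ⟩
      x ^ℚ (e * suc c) *q ∑ B lower ∎
    east : ∀ e b → cappedEast 1 e (suc c) (suc (c + a)) (suc (c + b)) ≡ x ^ℚ (e * suc c) *q ∑ B (upper e b)
    east zero b = sym (trans (cong (x ^ℚ 0 *q_) (∑-zero B (λ v _ → noRoom v))) (QP.*-zeroʳ (x ^ℚ 0)))
      where
      noRoom : ∀ v → upper 0 b v ≡ 0ℚ
      noRoom zero    = trans (cong (λ t → ι t *q capped 0 0 0 a b) (k>n⇒nCk≡0 (ℕP.n<1+n c)))
                             (QP.*-zeroˡ (capped 0 0 0 a b))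
      noRoom (suc v) = QP.*-zeroʳ (ι ((suc v + c) C suc c))
    east (suc e) zero = begin
      capped 2 e (suc c) (suc (c + a)) (c + 0)
        ≡⟨ capped-fewEast 2 e (suc c) (suc (c + a)) (c + 0) (c+0<1+c c) ⟩
      0ℚ
        ≡⟨ sym (trans (cong (x ^ℚ (suc e * suc c) *q_) (∑-zero B (λ v _ → QP.*-zeroʳ (ι ((v + c) C suc c)))))
                      (QP.*-zeroʳ (x ^ℚ (suc e * suc c)))) ⟩
      x ^ℚ (suc e * suc c) *q ∑ B (upper (suc e) 0) ∎
    east (suc e) (suc b) = begin
      capped 2 e (suc c) (suc (c + a)) (c + suc b)
        ≡⟨ cong (capped 2 e (suc c) (suc (c + a))) (ℕP.+-suc c b) ⟩
      capped 2 e (suc c) (suc c + a) (suc c + b)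
        ≡⟨ peakInsertion 1 e (suc c) a b B a<B ⟩
      x ^ℚ (suc e * suc c) *q ∑ B (λ v → ι ((v + suc c ∸ 1) C suc c) *q capped 1 e v a b)
        ≡⟨ cong (x ^ℚ (suc e * suc c) *q_)
                (∑-ext B (λ v → cong₂ _*q_ (cong (λ t → ι ((t ∸ 1) C suc c)) (ℕP.+-suc v c))
                                           (sym (capped-onCap e v a b)))) ⟩
      x ^ℚ (suc e * suc c) *q ∑ B (upper (suc e) (suc b)) ∎
  -- Strictly below the old cap: the first step is the same on both
  -- sides, and the remaining walk is handled by induction.
  peakInsertion (suc g) e c a b B a<B =
    trans (cong₂ _+q_ (stopPart c B a<B) (cong₂ _+q_ (northPart a c B a<B) (eastPart e b c)))
          (sym (withPeaks-capped (suc g) e c B a b))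
    where
    stopPart : ∀ c B → a < B → stop e c (c + a) (c + b) ≡ withPeaks (suc g) e c B (λ v → stop e v a b)
    stopPart zero    (suc B) _ = sym (trans (withPeaks-none (suc g) e (suc B) (λ v → stop e v a b)) (∑-stop B e a b))
    stopPart (suc c) B       _ = trans (stop-visit e c _ _) (sym (withPeaks-vanish (suc g) e (suc c) B _ noSlot))
      where
      noSlot : ∀ v → ι (insertions (suc g) v (suc c)) *q stop e v a b ≡ 0ℚ
      noSlot zero    = trans (cong (λ t → ι t *q stop e 0 a b) (k>n⇒nCk≡0 (ℕP.n<1+n c))) (QP.*-zeroˡ (stop e 0 a b))
      noSlot (suc v) = trans (cong (ι (insertions (suc g) (suc v) (suc c)) *q_) (stop-visit e v a b))
                             (QP.*-zeroʳ (ι (insertions (suc g) (suc v) (suc c))))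
    northPart : ∀ a c B → a < B →
      cappedNorth (suc (suc g)) e c (c + a) (c + b) ≡ withPeaks (suc g) e c B (λ v → cappedNorth (suc g) e v a b)
    northPart zero zero    B _ = sym (withPeaks-zero (suc g) e 0 B _ (λ v → refl))
    northPart zero (suc c) B _ =
      trans (cong (x ^ℚ e *q_) (capped-fewNorth (suc g) (suc e) (suc c) (c + 0) (suc c + b) (c+0<1+c c)))
            (trans (QP.*-zeroʳ (x ^ℚ e)) (sym (withPeaks-zero (suc g) e (suc c) B _ (λ v → refl))))
    northPart (suc a) c B a<B =
      trans (cong (λ t → cappedNorth (suc (suc g)) e c t (c + b)) (ℕP.+-suc c a)) (firstNorth g B a<B)
      where
      firstNorth : ∀ g B → suc a < B → x ^ℚ e *q capped (suc g) (suc e) c (c + a) (c + b)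
                                         ≡ withPeaks (suc g) e c B (λ v → cappedNorth (suc g) e v (suc a) b)
      -- reaching the old cap: its slots are counted from the first visit on
      firstNorth zero (suc B) (s≤s a<B) = begin
        x ^ℚ e *q capped 1 (suc e) c (c + a) (c + b)
          ≡⟨ cong (x ^ℚ e *q_) (peakInsertion 0 (suc e) c a b B a<B) ⟩
        x ^ℚ e *q withPeaks 0 (suc e) c B (λ v → capped 0 (suc e) v a b)
          ≡⟨ pullNorth e (suc e * c) B (λ v → ι ((v + c) C c)) (λ v → capped 0 (suc e) v a b) ⟩
        x ^ℚ (suc e * c) *q ∑ B (λ v → ι ((v + c) C c) *q (x ^ℚ e *q capped 0 (suc e) v a b))
          ≡⟨ cong (x ^ℚ (suc e * c) *q_) (sym noFirstSlot) ⟩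
        withPeaks 1 e c (suc B) (λ v → cappedNorth 1 e v (suc a) b) ∎
        where
        S = ∑ B (λ v → ι ((v + c) C c) *q (x ^ℚ e *q capped 0 (suc e) v a b))
        -- a north step onto the old cap is a visit, so v = 0 is impossible
        noFirstSlot : ι ((c ∸ 1) C c) *q 0ℚ +q S ≡ S
        noFirstSlot = trans (cong (_+q S) (QP.*-zeroʳ (ι ((c ∸ 1) C c)))) (QP.+-identityˡ S)
      firstNorth (suc g) B a<B = begin
        x ^ℚ e *q capped (suc (suc g)) (suc e) c (c + a) (c + b)
          ≡⟨ cong (x ^ℚ e *q_) (peakInsertion (suc g) (suc e) c a b B (ℕP.<-trans (ℕP.n<1+n a) a<B)) ⟩
        x ^ℚ e *q withPeaks (suc g) (suc e) c B (λ v → capped (suc g) (suc e) v a b)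
          ≡⟨ pullNorth e ((suc g + suc e) * c) B k (λ v → capped (suc g) (suc e) v a b) ⟩
        x ^ℚ ((suc g + suc e) * c) *q S
          ≡⟨ cong (λ t → x ^ℚ (t * c) *q S) (ℕP.+-suc (suc g) e) ⟩
        withPeaks (suc (suc g)) e c B (λ v → cappedNorth (suc (suc g)) e v (suc a) b) ∎
        where
        k = λ v → ι (insertions (suc g) v c)
        S = ∑ B (λ v → k v *q (x ^ℚ e *q capped (suc g) (suc e) v a b))
    eastPart : ∀ e b c →
      cappedEast (suc (suc g)) e c (c + a) (c + b) ≡ withPeaks (suc g) e c B (λ v → cappedEast (suc g) e v a b)
    eastPart zero    b       c       = sym (withPeaks-zero (suc g) 0 c B _ (λ v → refl))
    eastPart (suc e) zero    zero    = sym (withPeaks-zero (suc g) (suc e) 0 B _ (λ v → refl))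
    eastPart (suc e) zero    (suc c) =
      trans (capped-fewEast (suc (suc (suc g))) e (suc c) (suc c + a) (c + 0) (c+0<1+c c))
            (sym (withPeaks-zero (suc g) (suc e) (suc c) B _ (λ v → refl)))
    eastPart (suc e) (suc b) c = begin
      cappedEast (suc (suc g)) (suc e) c (c + a) (c + suc b)
        ≡⟨ cong (cappedEast (suc (suc g)) (suc e) c (c + a)) (ℕP.+-suc c b) ⟩
      capped (suc (suc (suc g))) e c (c + a) (c + b)
        ≡⟨ peakInsertion (suc (suc g)) e c a b B a<B ⟩
      withPeaks (suc (suc g)) e c B (λ v → capped (suc (suc g)) e v a b)
        ≡⟨ cong (λ t → x ^ℚ (t * c) *q ∑ B (λ v → ι (insertions (suc g) v c) *q capped (suc (suc g)) e v a b))
                (sym (ℕP.+-suc (suc g) e)) ⟩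
      withPeaks (suc g) (suc e) c B (λ v → cappedEast (suc g) (suc e) v a (suc b)) ∎

  -- touching h c M: Dyck paths of semilength M and height ≤ h that
  -- touch height h exactly c times.
  touching : ℕ → ℕ → ℕ → ℚ
  touching h c M = capped h 0 c M M

  -- Paths not touching the cap h + 1 are the paths of height ≤ h.
  touching-lower : ∀ h M → touching (suc h) 0 M ≡ ∑ (suc M) (λ v → touching h v M)
  touching-lower h M = trans (peakInsertion h 0 0 M M (suc M) (ℕP.n<1+n M))
                             (withPeaks-none h 0 (suc M) (λ v → touching h v M))

  -- Under the cap 1 the only Dyck path is (NE)^c, touching c times.
  touching-one : ∀ c → touching 1 c (c + 0) ≡ 1ℚ
  touching-one c = begin
    touching 1 c (c + 0)
      ≡⟨ peakInsertion 0 0 c 0 0 1 (s≤s z≤n) ⟩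
    1ℚ *q (ι ((0 + c) C c) *q 1ℚ +q 0ℚ)
      ≡⟨ cong (λ t → 1ℚ *q (ι t *q 1ℚ +q 0ℚ)) (nCn≡1 c) ⟩
    1ℚ ∎

  touching-one-long : ∀ c a → touching 1 c (c + suc a) ≡ 0ℚ
  touching-one-long c a = trans (peakInsertion 0 0 c (suc a) (suc a) (suc (suc a)) ℕP.≤-refl)
                                (withPeaks-zero 0 0 c (suc (suc a)) _ noPath)
    where
    noPath : ∀ v → capped 0 0 v (suc a) (suc a) ≡ 0ℚ
    noPath zero    = refl
    noPath (suc v) = refl

  touching-short : ∀ h d M → M < suc d + h → touching (suc h) (suc d) M ≡ 0ℚ
  touching-short zero    d M M< = capped-fewNorth 1 0 (suc d) M M (subst (M <_) (ℕP.+-identityʳ (suc d)) M<)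
  touching-short (suc g) d M M< with suc d ℕ.≤? M
  ... | no  d≮M = capped-fewNorth (suc (suc g)) 0 (suc d) M M (ℕP.≰⇒> d≮M)
  ... | yes d<M = begin
    touching (suc (suc g)) (suc d) M
      ≡⟨ cong (touching (suc (suc g)) (suc d)) (sym M≡) ⟩
    capped (suc (suc g)) 0 (suc d) (suc d + a) (suc d + a)
      ≡⟨ peakInsertion (suc g) 0 (suc d) a a (suc a) (ℕP.n<1+n a) ⟩
    withPeaks (suc g) 0 (suc d) (suc a) (λ v → touching (suc g) v a)
      ≡⟨ withPeaks-vanish (suc g) 0 (suc d) (suc a) (λ v → touching (suc g) v a) noTerm ⟩
    0ℚ ∎
    where
    a = M ∸ suc d
    M≡ : suc d + a ≡ M
    M≡ = ℕP.m+[n∸m]≡n d<M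
    a<g : a < suc g
    a<g = ℕP.+-cancelˡ-< (suc d) a (suc g) (subst (_< suc d + suc g) (sym M≡) M<)
    noTerm : ∀ v → ι ((v + suc d ∸ 1) C suc d) *q touching (suc g) v a ≡ 0ℚ
    noTerm zero    = trans (cong (λ t → ι t *q touching (suc g) 0 a) (k>n⇒nCk≡0 (ℕP.n<1+n d)))
                           (QP.*-zeroˡ (touching (suc g) 0 a))
    noTerm (suc v) = trans (cong (ι ((suc v + suc d ∸ 1) C suc d) *q_)
                                 (touching-short g v a (ℕP.<-≤-trans a<g (s≤s (ℕP.m≤n+m g v)))))
                           (QP.*-zeroʳ (ι ((suc v + suc d ∸ 1) C suc d)))

  -- below h M: Dyck paths of semilength M and height ≤ h.
  below : ℕ → ℕ → ℚ
  below h M = ∑ (suc M) (λ c → touching h c M)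

  -- reaching H M: Dyck paths of semilength M and height exactly H.
  reaching : ℕ → ℕ → ℚ
  reaching H M = ∑ M (λ d → touching H (suc d) M)

  below-zero : ∀ M → below 0 (suc M) ≡ 0ℚ
  below-zero M = ∑-zero (suc (suc M)) (λ c _ → cong (_+q (0ℚ +q 0ℚ)) (stop-north 0 c M (suc M)))

  telescope : ∀ H M → below H M ≡ below 0 M +q ∑ H (λ h → reaching (suc h) M)
  telescope zero    M = sym (QP.+-identityʳ (below 0 M))
  telescope (suc H) M = begin
    below (suc H) M
      ≡⟨ cong (_+q reaching (suc H) M) (touching-lower H M) ⟩
    below H M +q reaching (suc H) M
      ≡⟨ cong (_+q reaching (suc H) M) (telescope H M) ⟩
    (below 0 M +q ∑ H (λ h → reaching (suc h) M)) +q reaching (suc H) M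
      ≡⟨ QP.+-assoc (below 0 M) _ _ ⟩
    below 0 M +q (∑ H (λ h → reaching (suc h) M) +q reaching (suc H) M)
      ≡⟨ cong (below 0 M +q_) (sym (∑-last H (λ h → reaching (suc h) M))) ⟩
    below 0 M +q ∑ (suc H) (λ h → reaching (suc h) M) ∎

  catalan-reaching : ∀ n → qCatalan (suc n) x ≡ ∑ (suc n) (λ h → reaching (suc h) (suc n))
  catalan-reaching n = begin
    qCatalan (suc n) x
      ≡⟨ sumℚ-bfilter (isDyck (suc n)) (λ p → x ^ℚ coarea p) (allPaths (suc n + suc n)) ⟩
    sumℚ (map (pathWeight 0 (suc n) (suc n) 0) (allPaths (suc n + suc n)))
      ≡⟨ allPaths-walkSum (suc n + suc n) 0 (suc n) (suc n) 0 ⟩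
    walkSum (suc n + suc n) 0 (suc n) (suc n)
      ≡⟨ walkSum-capped (suc n + suc n) 0 (suc n) (suc n) (suc n) (suc (suc n))
                        refl (sym (ℕP.+-identityʳ (suc n))) ℕP.≤-refl (ℕP.n<1+n (suc n)) ⟩
    below (suc n) (suc n)
      ≡⟨ telescope (suc n) (suc n) ⟩
    below 0 (suc n) +q ∑ (suc n) (λ h → reaching (suc h) (suc n))
      ≡⟨ trans (cong (_+q ∑ (suc n) (λ h → reaching (suc h) (suc n))) (below-zero n)) (QP.+-identityˡ _) ⟩
    ∑ (suc n) (λ h → reaching (suc h) (suc n)) ∎

-- sumPartitions k m F sums F over the partitions with parts ≤ k and at
-- most m parts: either the empty one, or a largest part a + 1 ≤ k
-- followed by a partition with parts ≤ a + 1 and at most m - 1 parts.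
sumPartitions : ℕ → ℕ → (List ℕ → ℚ) → ℚ
sumPartitions k zero    F = F []
sumPartitions k (suc m) F = F [] +q ∑ k (λ a → sumPartitions (suc a) m (λ r → F (suc a ∷ r)))

FitsIn : ℕ → ℕ → List ℕ → Set
FitsIn k m       []      = ⊤
FitsIn k zero    (c ∷ r) = ⊥
FitsIn k (suc m) (c ∷ r) = c ≤ k × FitsIn c m r

sumPartitions-cong : ∀ k m {F G : List ℕ → ℚ} → (∀ r → FitsIn k m r → F r ≡ G r) →
                     sumPartitions k m F ≡ sumPartitions k m G
sumPartitions-cong k zero    h = h [] tt
sumPartitions-cong k (suc m) h = cong₂ _+q_ (h [] tt)
  (∑-cong k (λ a a<k → sumPartitions-cong (suc a) m (λ r fits → h (suc a ∷ r) (a<k , fits))))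

sumPartitions-*ˡ : ∀ k m c (F : List ℕ → ℚ) → c *q sumPartitions k m F ≡ sumPartitions k m (λ r → c *q F r)
sumPartitions-*ˡ k zero    c F = refl
sumPartitions-*ˡ k (suc m) c F = trans (QP.*-distribˡ-+ c (F []) _)
  (cong (c *q F [] +q_) (trans (∑-*ˡ k c _)
    (∑-ext k (λ a → sumPartitions-*ˡ (suc a) m c (λ r → F (suc a ∷ r))))))

sumPartitions-empty : ∀ m (F : List ℕ → ℚ) → sumPartitions 0 m F ≡ F []
sumPartitions-empty zero    F = refl
sumPartitions-empty (suc m) F = QP.+-identityʳ (F [])

sumPartitions-zero : ∀ k m → sumPartitions k m (λ _ → 0ℚ) ≡ 0ℚ
sumPartitions-zero k zero    = refl
sumPartitions-zero k (suc m) =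
  trans (cong (0ℚ +q_) (∑-zero k (λ a _ → sumPartitions-zero (suc a) m))) (QP.+-identityˡ 0ℚ)

sumPartitions-length : ∀ k m j (F : List ℕ → ℚ) → j ≤ m →
  sumPartitions k m (λ r → if length r ≤ᵇ j then F r else 0ℚ) ≡ sumPartitions k j F
sumPartitions-length k zero    zero    F _ = refl
sumPartitions-length k (suc m) zero    F _ =
  trans (cong (F [] +q_) (∑-zero k (λ a _ → sumPartitions-zero (suc a) m))) (QP.+-identityʳ (F []))
sumPartitions-length k (suc m) (suc j) F (s≤s j≤m) = cong (F [] +q_) (∑-ext k (λ a →
  trans (sumPartitions-cong (suc a) m (λ r _ → cong (λ t → if t then F (suc a ∷ r) else 0ℚ)
                                                   (suc≤ᵇsuc (length r) j)))
        (sumPartitions-length (suc a) m j (λ r → F (suc a ∷ r)) j≤m)))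

weight-cons : ∀ a b l → weight (a ∷ b ∷ l) ≡ ((a ∸ part l 1 + 1) C (b ∸ part l 1)) * weight (b ∷ l)
weight-cons a b l = cong (((a ∸ part l 1 + 1) C (b ∸ part l 1)) *_) (cong prodℕ
  (trans (map-applyUpTo suc factor (suc (suc (length l))))
         (sym (map-applyUpTo (λ i → i) (λ j → factor (suc j)) (suc (suc (length l)))))))
  where
  λ′ = a ∷ b ∷ l
  factor : ℕ → ℕ
  factor j = (part λ′ (suc j) ∸ part λ′ (suc j + 2) + 1) C (part λ′ (suc j + 1) ∸ part λ′ (suc j + 2))

-- exL (h + 1) z r is the exponent of x collected when the partition
-- (z, r₁, r₂, …) is rebuilt from peaks on h + 1 levels (see expandTop).
exL : ℕ → ℕ → List ℕ → ℕ
exL zero    z r       = 0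
exL (suc h) z []      = h * (z + 1) + exL h 0 []
exL (suc h) z (c ∷ r) = h * (z ∸ c + 1) + exL h c r

mutual
  exL-size : ∀ h z r → FitsIn z h r → exL (suc h) z r + size r ≡ suc h C 2 + h * z
  exL-size zero    z []            _            = refl
  exL-size (suc g) z []            _            = exL-step g z 0 [] z≤n tt
  exL-size (suc g) z (c ∷ r) (c≤z , fits) = exL-step g z c r c≤z fits

  exL-step : ∀ g z c r → c ≤ z → FitsIn c g r →
    (suc g * (z ∸ c + 1) + exL (suc g) c r) + (c + size r) ≡ suc (suc g) C 2 + suc g * z
  exL-step g z c r c≤z fits = begin
    (suc g * (z ∸ c + 1) + exL (suc g) c r) + (c + size r)
      ≡⟨ regroup g (z ∸ c) (exL (suc g) c r) c (size r) ⟩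
    suc g * (z ∸ c + 1) + c + (exL (suc g) c r + size r)
      ≡⟨ cong (suc g * (z ∸ c + 1) + c +_) (exL-size g c r fits) ⟩
    suc g * (z ∸ c + 1) + c + (suc g C 2 + g * c)
      ≡⟨ collect g (z ∸ c) c (suc g C 2) ⟩
    (suc g + suc g C 2) + suc g * (c + (z ∸ c))
      ≡⟨ cong₂ (λ u v → (u + suc g C 2) + suc g * v) (sym (nC1≡n (suc g))) (ℕP.m+[n∸m]≡n c≤z) ⟩
    (suc g C 1 + suc g C 2) + suc g * z
      ≡⟨ cong (_+ suc g * z) (nCk+nC[k+1]≡[n+1]C[k+1] (suc g) 1) ⟩
    suc (suc g) C 2 + suc g * z ∎
    where
    open ℕSolver.+-*-Solver
    regroup : ∀ g w e c t → (suc g * (w + 1) + e) + (c + t) ≡ suc g * (w + 1) + c + (e + t)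
    regroup = solve 5 (λ g w e c t → ((con 1 :+ g) :* (w :+ con 1) :+ e) :+ (c :+ t)
                                   := (con 1 :+ g) :* (w :+ con 1) :+ c :+ (e :+ t)) refl
    collect : ∀ g w c B → suc g * (w + 1) + c + (B + g * c) ≡ (suc g + B) + suc g * (c + w)
    collect = solve 4 (λ g w c B → (con 1 :+ g) :* (w :+ con 1) :+ c :+ (B :+ g :* c)
                                 := ((con 1 :+ g) :+ B) :+ (con 1 :+ g) :* (c :+ w)) refl

binom2-split : ∀ z h r → FitsIn z h r → (z + suc h) C 2 ≡ (z C 2 + size (z ∷ r)) + exL (suc h) z r
binom2-split z h r fits = begin
  (z + suc h) C 2                               ≡⟨ [m+n]C2 z (suc h) ⟩
  z C 2 + suc h C 2 + z * suc h                 ≡⟨ regroup (z C 2) z (suc h C 2) h ⟩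
  (z C 2 + z) + (suc h C 2 + h * z)             ≡⟨ cong ((z C 2 + z) +_) (sym (exL-size h z r fits)) ⟩
  (z C 2 + z) + (exL (suc h) z r + size r)      ≡⟨ reorder (z C 2) z (size r) (exL (suc h) z r) ⟩
  (z C 2 + (z + size r)) + exL (suc h) z r      ∎
  where
  open ℕSolver.+-*-Solver
  regroup : ∀ a z b h → a + b + z * suc h ≡ (a + z) + (b + h * z)
  regroup = solve 4 (λ a z b h → a :+ b :+ z :* (con 1 :+ h) := (a :+ z) :+ (b :+ h :* z)) refl
  reorder : ∀ a z t e → (a + z) + (e + t) ≡ (a + (z + t)) + e
  reorder = solve 4 (λ a z t e → (a :+ z) :+ (e :+ t) := (a :+ (z :+ t)) :+ e) refl

isPartition-cons : ∀ a l → isPartition (suc a ∷ l) ≡ isPartition l ∧ (part l 1 ≤ᵇ suc a)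
isPartition-cons a []      = refl
isPartition-cons a (c ∷ l) = BP.∧-comm (c ≤ᵇ suc a) (isPartition (c ∷ l))

sumℚ-boundedLists : ∀ m b k (F : List ℕ → ℚ) → k ≤ b →
  sumℚ (map (λ l → if isPartition l ∧ (part l 1 ≤ᵇ k) then F l else 0ℚ) (boundedLists b m))
    ≡ sumPartitions k m F
sumℚ-boundedLists zero    b k F _   = QP.+-identityʳ (F [])
sumℚ-boundedLists (suc m) b k F k≤b = cong (F [] +q_) (begin
  sumℚ (map admit (concatMap (λ a → map (suc a ∷_) (boundedLists b m)) (upTo b)))
    ≡⟨ sumℚ-concatMap admit (λ a → map (suc a ∷_) (boundedLists b m)) (upTo b) ⟩
  sumℚ (map (λ a → sumℚ (map admit (map (suc a ∷_) (boundedLists b m)))) (upTo b))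
    ≡⟨ sumℚ-upTo (λ a → sumℚ (map admit (map (suc a ∷_) (boundedLists b m)))) b ⟩
  ∑ b (λ a → sumℚ (map admit (map (suc a ∷_) (boundedLists b m))))
    ≡⟨ ∑-ext b (λ a → cong sumℚ (sym (map-∘ (boundedLists b m)))) ⟩
  ∑ b (λ a → sumℚ (map (λ l → admit (suc a ∷ l)) (boundedLists b m)))
    ≡⟨ ∑-trim k b _ k≤b tooLarge ⟩
  ∑ k (λ a → sumℚ (map (λ l → admit (suc a ∷ l)) (boundedLists b m)))
    ≡⟨ ∑-cong k (λ a a<k → trans (sumℚ-cong (boundedLists b m) (admit-cons a a<k))
                                  (sumℚ-boundedLists m b (suc a) (λ l → F (suc a ∷ l)) (ℕP.≤-trans a<k k≤b))) ⟩
  ∑ k (λ a → sumPartitions (suc a) m (λ r → F (suc a ∷ r))) ∎)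
  where
  admit : List ℕ → ℚ
  admit l = if isPartition l ∧ (part l 1 ≤ᵇ k) then F l else 0ℚ
  tooLarge : ∀ a → k ≤ a → a < b → sumℚ (map (λ l → admit (suc a ∷ l)) (boundedLists b m)) ≡ 0ℚ
  tooLarge a k≤a _ = sumℚ-zero (boundedLists b m) (λ l → cong (λ t → if t then F (suc a ∷ l) else 0ℚ)
    (trans (cong (isPartition (suc a ∷ l) ∧_) (≤ᵇ-false (s≤s k≤a))) (BP.∧-zeroʳ _)))
  admit-cons : ∀ a → a < k → ∀ l →
    admit (suc a ∷ l) ≡ (if isPartition l ∧ (part l 1 ≤ᵇ suc a) then F (suc a ∷ l) else 0ℚ)
  admit-cons a a<k l = cong (λ t → if t then F (suc a ∷ l) else 0ℚ)
    (trans (cong (isPartition (suc a ∷ l) ∧_) (≤ᵇ-true a<k))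
           (trans (BP.∧-identityʳ _) (isPartition-cons a l)))

if-strengthen : ∀ p c d (y : ℚ) → (T c → T d) →
  (if p ∧ c then y else 0ℚ) ≡ (if p ∧ d then (if c then y else 0ℚ) else 0ℚ)
if-strengthen false c     d     y _   = refl
if-strengthen true  true  true  y _   = refl
if-strengthen true  true  false y c⇒d = ⊥-elim (c⇒d tt)
if-strengthen true  false true  y _   = refl
if-strengthen true  false false y _   = refl

sumℚ-partitionsFor : ∀ n (F : List ℕ → ℚ) →
  sumℚ (map F (partitionsFor n)) ≡ sumPartitions n n (λ l → if part l 1 + length l ≤ᵇ n then F l else 0ℚ)
sumℚ-partitionsFor n F =
  trans (sumℚ-bfilter (λ l → isPartition l ∧ (part l 1 + length l ≤ᵇ n)) F (boundedLists n n))
        (trans (sumℚ-cong (boundedLists n n) (λ l → if-strengthen (isPartition l) _ _ (F l) (largest≤ l)))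
               (sumℚ-boundedLists n n n _ ℕP.≤-refl))
  where
  largest≤ : ∀ l → T (part l 1 + length l ≤ᵇ n) → T (part l 1 ≤ᵇ n)
  largest≤ l t = ℕP.≤⇒≤ᵇ (ℕP.≤-trans (ℕP.m≤m+n (part l 1) (length l)) (ℕP.≤ᵇ⇒≤ _ n t))

module Expansion (x : ℚ) where
  open Paths x

  -- The summand attached to the partition (z, r) of a top level h + 1,
  -- with a weight φ on the part following z.
  layered : ℕ → ℕ → (ℕ → ℚ) → List ℕ → ℚ
  layered h z φ r = φ (part r 1) *q (ι (weight (z ∷ r)) *q x ^ℚ exL (suc h) z r)

  -- The first factor of weight (z ∷ p ∷ r), seen as a weight on r's largest part.
  nextFactor : ℕ → ℕ → ℕ → ℚ
  nextFactor z p c = ι ((z ∸ c + 1) C (p ∸ c))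

  mutual
    -- Paths of semilength z + h + 1 touching their top level h + 1
    -- exactly d + 1 times, weighted by φ (z - d), expand into the
    -- partitions (z, r) with r fitting under (z, h).
    expandTop : ∀ h z (φ : ℕ → ℚ) →
      ∑ (suc z) (λ d → φ (z ∸ d) *q touching (suc h) (suc d) (z + suc h))
        ≡ sumPartitions z h (layered h z φ)
    expandTop zero z φ = begin
      ∑ (suc z) (λ d → φ (z ∸ d) *q touching 1 (suc d) (z + 1))
        ≡⟨ ∑-last z (λ d → φ (z ∸ d) *q touching 1 (suc d) (z + 1)) ⟩
      ∑ z (λ d → φ (z ∸ d) *q touching 1 (suc d) (z + 1)) +q φ (z ∸ z) *q touching 1 (suc z) (z + 1)
        ≡⟨ cong₂ _+q_ (∑-zero z (λ d d<z → trans (cong (φ (z ∸ d) *q_) (tooMany d d<z))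
                                                 (QP.*-zeroʳ (φ (z ∸ d)))))
                      (cong₂ _*q_ (cong φ (ℕP.n∸n≡0 z)) all) ⟩
      0ℚ +q φ 0 *q 1ℚ
        ≡⟨ QP.+-identityˡ _ ⟩
      layered 0 z φ [] ∎
      where
      tooMany : ∀ d → d < z → touching 1 (suc d) (z + 1) ≡ 0ℚ
      tooMany d d<z = trans (cong (touching 1 (suc d)) z+1≡) (touching-one-long (suc d) (z ∸ suc d))
        where
        z+1≡ : z + 1 ≡ suc d + suc (z ∸ suc d)
        z+1≡ = trans (ℕP.+-comm z 1) (trans (cong suc (sym (ℕP.m+[n∸m]≡n d<z)))
                                           (sym (ℕP.+-suc (suc d) (z ∸ suc d))))
      all : touching 1 (suc z) (z + 1) ≡ 1ℚ
      all = trans (cong (touching 1 (suc z)) (trans (ℕP.+-comm z 1) (sym (ℕP.+-identityʳ (suc z)))))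
                  (touching-one (suc z))
    expandTop (suc g) z φ = begin
      ∑ (suc z) (λ d → φ (z ∸ d) *q touching (suc (suc g)) (suc d) (z + suc (suc g)))
        ≡⟨ ∑-cong (suc z) (λ d d≤z → cong (φ (z ∸ d) *q_) (byLayer d d≤z)) ⟩
      ∑ (suc z) (λ d → f (z ∸ d))
        ≡⟨ ∑-reverse (suc z) f ⟩
      f 0 +q ∑ z (λ a → f (suc a))
        ≡⟨ cong₂ _+q_ noPart (∑-ext z largestPart) ⟩
      sumPartitions z (suc g) (layered (suc g) z φ) ∎
      where
      -- f p: the paths whose next part, after peeling off the top level, is p
      f : ℕ → ℚ
      f p = φ p *q (x ^ℚ (suc g * (z ∸ p + 1)) *q sumPartitions p g (layered g p (nextFactor z p)))
      byLayer : ∀ d → d < suc z → touching (suc (suc g)) (suc d) (z + suc (suc g))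
        ≡ x ^ℚ (suc g * (z ∸ (z ∸ d) + 1)) *q sumPartitions (z ∸ d) g (layered g (z ∸ d) (nextFactor z (z ∸ d)))
      byLayer d (s≤s d≤z) = trans (topLayer g z d d≤z)
        (cong (λ t → x ^ℚ (suc g * (t + 1)) *q sumPartitions (z ∸ d) g (layered g (z ∸ d) (nextFactor z (z ∸ d))))
              (sym (ℕP.m∸[m∸n]≡n d≤z)))
      -- the empty partition: a single peak on every level
      noPart : f 0 ≡ layered (suc g) z φ []
      noPart = cong (φ 0 *q_) (begin
        x ^ℚ (suc g * (z + 1)) *q sumPartitions 0 g (layered g 0 (nextFactor z 0))
          ≡⟨ cong (x ^ℚ (suc g * (z + 1)) *q_) (sumPartitions-empty g _) ⟩
        x ^ℚ (suc g * (z + 1)) *q (1ℚ *q (1ℚ *q x ^ℚ exL (suc g) 0 []))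
          ≡⟨ cong (x ^ℚ (suc g * (z + 1)) *q_) (trans (QP.*-identityˡ _) (QP.*-identityˡ _)) ⟩
        x ^ℚ (suc g * (z + 1)) *q x ^ℚ exL (suc g) 0 []
          ≡⟨ sym (^ℚ-+ x (suc g * (z + 1)) (exL (suc g) 0 [])) ⟩
        x ^ℚ exL (suc (suc g)) z []
          ≡⟨ sym (QP.*-identityˡ _) ⟩
        ι (weight (z ∷ [])) *q x ^ℚ exL (suc (suc g)) z [] ∎)
      largestPart : ∀ a → f (suc a) ≡ sumPartitions (suc a) g (λ r → layered (suc g) z φ (suc a ∷ r))
      largestPart a = begin
        φ (suc a) *q (X *q sumPartitions (suc a) g (layered g (suc a) (nextFactor z (suc a))))
          ≡⟨ cong (φ (suc a) *q_) (sumPartitions-*ˡ (suc a) g X _) ⟩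
        φ (suc a) *q sumPartitions (suc a) g (λ r → X *q layered g (suc a) (nextFactor z (suc a)) r)
          ≡⟨ sumPartitions-*ˡ (suc a) g (φ (suc a)) _ ⟩
        sumPartitions (suc a) g (λ r → φ (suc a) *q (X *q layered g (suc a) (nextFactor z (suc a)) r))
          ≡⟨ sumPartitions-cong (suc a) g (λ r _ → cong (φ (suc a) *q_) (merge r)) ⟩
        sumPartitions (suc a) g (λ r → layered (suc g) z φ (suc a ∷ r)) ∎
        where
        X = x ^ℚ (suc g * (z ∸ suc a + 1))
        merge : ∀ r → X *q layered g (suc a) (nextFactor z (suc a)) r
                      ≡ ι (weight (z ∷ suc a ∷ r)) *q x ^ℚ exL (suc (suc g)) z (suc a ∷ r)
        merge r = begin
          X *q (ι β *q (ι w *q x ^ℚ ex))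
            ≡⟨ regroup X (ι β) (ι w) (x ^ℚ ex) ⟩
          (ι β *q ι w) *q (X *q x ^ℚ ex)
            ≡⟨ cong₂ _*q_ (trans (sym (ι-* β w)) (cong ι (sym (weight-cons z (suc a) r))))
                          (sym (^ℚ-+ x (suc g * (z ∸ suc a + 1)) ex)) ⟩
          ι (weight (z ∷ suc a ∷ r)) *q x ^ℚ exL (suc (suc g)) z (suc a ∷ r) ∎
          where
          β = (z ∸ part r 1 + 1) C (suc a ∸ part r 1)
          w = weight (suc a ∷ r)
          ex = exL (suc g) (suc a) r
          open QSolver.+-*-Solver
          regroup : ∀ X B W Y → X *q (B *q (W *q Y)) ≡ (B *q W) *q (X *q Y)
          regroup = solve 4 (λ X B W Y → X :* (B :* (W :* Y)) := (B :* W) :* (X :* Y)) refl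

    -- The top level of paths touching it d + 1 times: deleting the d + 1
    -- peaks leaves paths under the level g + 1 touching it v + 1 ≤ p + 1
    -- times (p = z - d), among whose v + 1 slots the peaks are spread.
    topLayer : ∀ g z d → d ≤ z → touching (suc (suc g)) (suc d) (z + suc (suc g))
      ≡ x ^ℚ (suc g * (d + 1)) *q sumPartitions (z ∸ d) g (layered g (z ∸ d) (nextFactor z (z ∸ d)))
    topLayer g z d d≤z = begin
      touching (suc (suc g)) (suc d) (z + suc (suc g))
        ≡⟨ cong (touching (suc (suc g)) (suc d)) z+g+2≡ ⟩
      touching (suc (suc g)) (suc d) (suc d + M)
        ≡⟨ peakInsertion (suc g) 0 (suc d) M M (suc M) (ℕP.n<1+n M) ⟩
      x ^ℚ K *q (ι (d C suc d) *q touching (suc g) 0 M +q ∑ M term)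
        ≡⟨ cong (λ t → x ^ℚ K *q (t +q ∑ M term))
                (trans (cong (λ t → ι t *q touching (suc g) 0 M) (k>n⇒nCk≡0 (ℕP.n<1+n d)))
                       (QP.*-zeroˡ (touching (suc g) 0 M))) ⟩
      x ^ℚ K *q (0ℚ +q ∑ M term)
        ≡⟨ cong₂ _*q_ (cong (x ^ℚ_) K≡) (trans (QP.+-identityˡ _) (∑-trim (suc p) M term p<M tooMany)) ⟩
      x ^ℚ (suc g * (d + 1)) *q ∑ (suc p) term
        ≡⟨ cong (x ^ℚ (suc g * (d + 1)) *q_) (∑-cong (suc p) (λ v v≤p → cong (_*q touching (suc g) (suc v) M)
                                                                              (slots v v≤p))) ⟩
      x ^ℚ (suc g * (d + 1)) *q ∑ (suc p) (λ v → nextFactor z p (p ∸ v) *q touching (suc g) (suc v) (p + suc g))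
        ≡⟨ cong (x ^ℚ (suc g * (d + 1)) *q_) (expandTop g p (nextFactor z p)) ⟩
      x ^ℚ (suc g * (d + 1)) *q sumPartitions p g (layered g p (nextFactor z p)) ∎
      where
      p = z ∸ d
      M = p + suc g
      K = (suc g + 0) * suc d
      term : ℕ → ℚ
      term v = ι ((v + suc d) C suc d) *q touching (suc g) (suc v) M
      K≡ : K ≡ suc g * (d + 1)
      K≡ = cong₂ _*_ (ℕP.+-identityʳ (suc g)) (ℕP.+-comm 1 d)
      z+g+2≡ : z + suc (suc g) ≡ suc d + M
      z+g+2≡ = begin
        z + suc (suc g)           ≡⟨ cong (_+ suc (suc g)) (sym (ℕP.m+[n∸m]≡n d≤z)) ⟩
        (d + p) + suc (suc g)     ≡⟨ ℕP.+-assoc d p (suc (suc g)) ⟩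
        d + (p + suc (suc g))     ≡⟨ cong (d +_) (ℕP.+-suc p (suc g)) ⟩
        d + suc M                 ≡⟨ ℕP.+-suc d M ⟩
        suc d + M ∎
      p<M : suc p ≤ M
      p<M = subst (suc p ≤_) (sym (ℕP.+-suc p g)) (s≤s (ℕP.m≤m+n p g))
      tooMany : ∀ v → suc p ≤ v → v < M → term v ≡ 0ℚ
      tooMany v p<v _ = trans (cong (ι ((v + suc d) C suc d) *q_) (touching-short g v M short))
                              (QP.*-zeroʳ (ι ((v + suc d) C suc d)))
        where
        short : M < suc v + g
        short = subst (_< suc v + g) (sym (ℕP.+-suc p g)) (s≤s (ℕP.+-monoˡ-< g p<v))
      -- v + 1 slots receive d + 1 peaks: binom(v + d + 1, d + 1) ways.
      slots : ∀ v → v < suc p → ι ((v + suc d) C suc d) ≡ nextFactor z p (p ∸ v)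
      slots v (s≤s v≤p) = cong ι (begin
        (v + suc d) C suc d                   ≡⟨ cong (_C suc d) (ℕP.+-comm v (suc d)) ⟩
        (suc d + v) C suc d                   ≡⟨ nCk≡nC[n∸k] (ℕP.m≤m+n (suc d) v) ⟩
        (suc d + v) C (suc d + v ∸ suc d)     ≡⟨ cong₂ _C_ top (trans (ℕP.m+n∸m≡n (suc d) v)
                                                                      (sym (ℕP.m∸[m∸n]≡n v≤p))) ⟩
        (z ∸ (p ∸ v) + 1) C (p ∸ (p ∸ v)) ∎)
        where
        top : suc d + v ≡ z ∸ (p ∸ v) + 1
        top = begin
          suc d + v                 ≡⟨ ℕP.+-comm 1 (d + v) ⟩
          d + v + 1                 ≡⟨ cong (λ t → d + t + 1) (sym (ℕP.m∸[m∸n]≡n v≤p)) ⟩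
          d + (p ∸ (p ∸ v)) + 1     ≡⟨ cong (_+ 1) (sym (ℕP.+-∸-assoc d (ℕP.m∸n≤m p v))) ⟩
          d + p ∸ (p ∸ v) + 1       ≡⟨ cong (λ t → t ∸ (p ∸ v) + 1) (ℕP.m+[n∸m]≡n d≤z) ⟩
          z ∸ (p ∸ v) + 1 ∎

  reaching-partitions : ∀ h z → reaching (suc h) (z + suc h) ≡ sumPartitions z h (layered h z (λ _ → 1ℚ))
  reaching-partitions h z = begin
    ∑ (z + suc h) (λ d → touching (suc h) (suc d) (z + suc h))
      ≡⟨ ∑-trim (suc z) (z + suc h) (λ d → touching (suc h) (suc d) (z + suc h)) z<z+h+1 tooMany ⟩
    ∑ (suc z) (λ d → touching (suc h) (suc d) (z + suc h))
      ≡⟨ ∑-ext (suc z) (λ d → sym (QP.*-identityˡ (touching (suc h) (suc d) (z + suc h)))) ⟩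
    ∑ (suc z) (λ d → 1ℚ *q touching (suc h) (suc d) (z + suc h))
      ≡⟨ expandTop h z (λ _ → 1ℚ) ⟩
    sumPartitions z h (layered h z (λ _ → 1ℚ)) ∎
    where
    z<z+h+1 : suc z ≤ z + suc h
    z<z+h+1 = subst (suc z ≤_) (sym (ℕP.+-suc z h)) (s≤s (ℕP.m≤m+n z h))
    tooMany : ∀ d → suc z ≤ d → d < z + suc h → touching (suc h) (suc d) (z + suc h) ≡ 0ℚ
    tooMany d z<d _ = touching-short h d (z + suc h)
      (subst (_< suc d + h) (sym (ℕP.+-suc z h)) (s≤s (ℕP.+-monoˡ-< h z<d)))

module Substitution (q : ℚ) .{{_ : NonZero q}} where
  open Paths (1/ q)
  open Expansion (1/ q)

  rhsTerm : List ℕ → ℚ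
  rhsTerm l = ι (weight l) *q q ^ℚ (part l 1 C 2 + size l)

  layered-rhsTerm : ∀ z h r → FitsIn z h r →
    q ^ℚ ((z + suc h) C 2) *q layered h z (λ _ → 1ℚ) r ≡ rhsTerm (z ∷ r)
  layered-rhsTerm z h r fits = begin
    q ^ℚ ((z + suc h) C 2) *q (1ℚ *q (ι w *q x ^ℚ e))
      ≡⟨ cong₂ (λ t u → q ^ℚ t *q u) (binom2-split z h r fits) (QP.*-identityˡ _) ⟩
    q ^ℚ (P + e) *q (ι w *q x ^ℚ e)
      ≡⟨ cong (_*q (ι w *q x ^ℚ e)) (^ℚ-+ q P e) ⟩
    (q ^ℚ P *q q ^ℚ e) *q (ι w *q x ^ℚ e)
      ≡⟨ *q-interchange (q ^ℚ P) (q ^ℚ e) (ι w) (x ^ℚ e) ⟩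
    (q ^ℚ P *q ι w) *q (q ^ℚ e *q x ^ℚ e)
      ≡⟨ cong₂ _*q_ (QP.*-comm (q ^ℚ P) (ι w)) (^ℚ-inverse q e) ⟩
    (ι w *q q ^ℚ P) *q 1ℚ
      ≡⟨ QP.*-identityʳ _ ⟩
    rhsTerm (z ∷ r) ∎
    where
    x = 1/ q
    w = weight (z ∷ r)
    e = exL (suc h) z r
    P = z C 2 + size (z ∷ r)

  -- Both sides restricted to largest part z (so height n - z).
  byLargest : ∀ z h → q ^ℚ ((z + suc h) C 2) *q reaching (suc h) (z + suc h)
                        ≡ sumPartitions z h (λ r → rhsTerm (z ∷ r))
  byLargest z h = begin
    q ^ℚ ((z + suc h) C 2) *q reaching (suc h) (z + suc h)
      ≡⟨ cong (q ^ℚ ((z + suc h) C 2) *q_) (reaching-partitions h z) ⟩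
    q ^ℚ ((z + suc h) C 2) *q sumPartitions z h (layered h z (λ _ → 1ℚ))
      ≡⟨ sumPartitions-*ˡ z h (q ^ℚ ((z + suc h) C 2)) (layered h z (λ _ → 1ℚ)) ⟩
    sumPartitions z h (λ r → q ^ℚ ((z + suc h) C 2) *q layered h z (λ _ → 1ℚ) r)
      ≡⟨ sumPartitions-cong z h (layered-rhsTerm z h) ⟩
    sumPartitions z h (λ r → rhsTerm (z ∷ r)) ∎

  -- The theorem for semilength n + 1, sorting both sides by the largest
  -- part z of λ, i.e. by the height n + 1 - z of the paths.
  identity : ∀ n → q ^ℚ (suc n C 2) *q qCatalan (suc n) (1/ q) ≡ rhs (suc n) q
  identity n = begin
    Q *q qCatalan (suc n) (1/ q)
      ≡⟨ cong (Q *q_) (catalan-reaching n) ⟩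
    Q *q ∑ (suc n) (λ h → reaching (suc h) (suc n))
      ≡⟨ cong (Q *q_) (sym (∑-reverse (suc n) (λ h → reaching (suc h) (suc n)))) ⟩
    Q *q ∑ (suc n) (λ z → reaching (suc (n ∸ z)) (suc n))
      ≡⟨ ∑-*ˡ (suc n) Q (λ z → reaching (suc (n ∸ z)) (suc n)) ⟩
    ∑ (suc n) (λ z → Q *q reaching (suc (n ∸ z)) (suc n))
      ≡⟨ cong₂ _+q_ emptyPartition (∑-cong n largestPart) ⟩
    F [] +q ∑ n withLargest
      ≡⟨ cong (F [] +q_) (sym (∑-trim n (suc n) withLargest (ℕP.n≤1+n n) (λ a n≤a _ → tooLarge a n≤a))) ⟩
    sumPartitions (suc n) (suc n) F
      ≡⟨ sym (sumℚ-partitionsFor (suc n) rhsTerm) ⟩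
    rhs (suc n) q ∎
    where
    Q = q ^ℚ (suc n C 2)
    F : List ℕ → ℚ
    F l = if part l 1 + length l ≤ᵇ suc n then rhsTerm l else 0ℚ
    withLargest : ℕ → ℚ
    withLargest a = sumPartitions (suc a) n (λ r → F (suc a ∷ r))
    emptyPartition : Q *q reaching (suc n) (suc n) ≡ F []
    emptyPartition = trans (byLargest 0 n) (sumPartitions-empty n (λ r → rhsTerm (0 ∷ r)))
    largestPart : ∀ a → a < n → Q *q reaching (suc (n ∸ suc a)) (suc n) ≡ withLargest a
    largestPart a a<n = begin
      Q *q reaching (suc h) (suc n)
        ≡⟨ cong (λ m → q ^ℚ (m C 2) *q reaching (suc h) m) n+1≡ ⟩
      q ^ℚ ((suc a + suc h) C 2) *q reaching (suc h) (suc a + suc h)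
        ≡⟨ byLargest (suc a) h ⟩
      sumPartitions (suc a) h (λ r → rhsTerm (suc a ∷ r))
        ≡⟨ sym (sumPartitions-length (suc a) n h (λ r → rhsTerm (suc a ∷ r)) (ℕP.m∸n≤m n (suc a))) ⟩
      sumPartitions (suc a) n (λ r → if length r ≤ᵇ h then rhsTerm (suc a ∷ r) else 0ℚ)
        ≡⟨ sumPartitions-cong (suc a) n (λ r _ → cong (λ t → if t then rhsTerm (suc a ∷ r) else 0ℚ)
                                                     (sym (fits r))) ⟩
      withLargest a ∎
      where
      h = n ∸ suc a
      n+1≡ : suc n ≡ suc a + suc h
      n+1≡ = sym (trans (ℕP.+-suc (suc a) h) (cong suc (ℕP.m+[n∸m]≡n a<n)))
      fits : ∀ r → (suc a + suc (length r) ≤ᵇ suc n) ≡ (length r ≤ᵇ h)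
      fits r = trans (cong (suc a + suc (length r) ≤ᵇ_) n+1≡)
                     (trans (+-≤ᵇ (suc a) (suc (length r)) (suc h)) (suc≤ᵇsuc (length r) h))
    -- λ₁ ≥ n + 1 leaves no room for any part: λ₁ + k > n + 1
    tooLarge : ∀ a → n ≤ a → withLargest a ≡ 0ℚ
    tooLarge a n≤a =
      trans (sumPartitions-cong (suc a) n (λ r _ → cong (λ t → if t then rhsTerm (suc a ∷ r) else 0ℚ)
                                                        (≤ᵇ-false (exceeds (length r)))))
            (sumPartitions-zero (suc a) n)
      where
      exceeds : ∀ L → suc n < suc a + suc L
      exceeds L = ℕP.<-≤-trans (ℕP.m<m+n (suc n) (s≤s z≤n)) (ℕP.+-monoˡ-≤ (suc L) (s≤s n≤a))

theorem1p2 : (n : ℕ) → n ≥ 1 → (q : ℚ) → .{{_ : NonZero q}} →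
    q ^ℚ (n C 2) Data.Rational.* qCatalan n (1/ q) ≡ rhs n q
theorem1p2 (suc n) _ q = Substitution.identity q n
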